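{- Fix $n\in\mathbb{N}$, $a_1,\dots,a_n\in\mathbb{N}$, and $s_0,t_0\in\mathbb{N}$ with $s_0<t_0$, $\gcd(s_0,t_0)=1$; put $w_0:=s_0/t_0$. Then there are unique $w_1,\dots,w_n\in\mathbb{Q}\cap(0,1)$ with $a_jw_j+w_{j-1}=1$ for $j=1,\dots,n$. Write $w_j=s_j/t_j$ with $s_j,t_j\in\mathbb{N}$, $\gcd(s_j,t_j)=1$, and let $\beta_j:=\gcd(t_{j-1}-s_{j-1},a_j)$ and $\alpha_j:=a_j/\beta_j$ for $j=1,\dots,n$. Then for $j=1,\dots,n$ $$s_j=\frac{\rho(a_{j-1},\dots,a_1)\cdot t_0+(-1)^js_0}{\beta_j\cdots\beta_1},\qquad t_j=\alpha_jt_{j-1}=\alpha_j\cdots\alpha_1\cdot t_0,$$ and $$\prod_{j=1}^n\left(\frac{1}{s_j}\Lambda_{t_j}-\Lambda_1\right)=(-1)^n\Lambda_1+\sum_{j=1}^n(-1)^{n-j}\frac{\beta_j\cdots\beta_1}{t_0-s_0}\Lambda_{t_j}=(-1)^nE_1+\sum_{j=1}^n(-1)^{n-j}\frac{a_j\cdots a_1}{1-w_0}E_{t_j},$$ $$\prod_{j=1}^n\left(\frac{1}{w_j}-1\right)=\frac{\rho(a_n,a_{n-1},\dots,a_1)+(-1)^{n-1}w_0}{1-w_0}.$$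
   Context: $\rho(x_1,\dots,x_k):=x_1\cdots x_k-x_2\cdots x_k+\dots+(-1)^{k-1}x_k+(-1)^k$ for integers $x_1,\dots,x_k$, with $\rho(\emptyset)=1$. $S^{UR}$ is the set of roots of unity and $\mathbb{Q}\langle S^{UR}\rangle$ the group ring with basis $\langle\zeta\rangle$ ($\zeta\in S^{UR}$), multiplication $\langle\zeta_1\rangle\langle\zeta_2\rangle=\langle\zeta_1\zeta_2\rangle$. For $m\in\mathbb{N}$, $\Lambda_m:=\sum_{a=0}^{m-1}\langle e^{2\pi ia/m}\rangle$ and $E_m:=\frac1m\Lambda_m$. -}

module Defs where

open import Data.Nat as ℕ using (ℕ; zero; suc; _∸_; _≤_; _<_)
open import Data.Nat.GCD using (gcd)
open import Data.Nat.DivMod as DM using ()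
open import Data.Integer as ℤ using (ℤ; +_)
open import Data.Rational as ℚ using (ℚ; 0ℚ; 1ℚ; _÷_; ≢-nonZero; ↥_; ↧ₙ_)
open import Data.Rational.Properties using (_≟_)
open import Data.List using (List; []; _∷_; _++_; map; concatMap; foldr; upTo; drop; length; filter)
open import Data.Product using (_×_; _,_; proj₁; proj₂; ∃)
open import Relation.Binary.PropositionalEquality using (_≡_)
open import Relation.Nullary using (yes; no)

sgn : ℕ → ℤ
sgn zero = ℤ.+ 1
sgn (suc j) = ℤ.- sgn j

sgnℚ : ℕ → ℚ
sgnℚ j = sgn j ℚ./ 1

ℕ→ℚ : ℕ → ℚ
ℕ→ℚ m = (+ m) ℚ./ 1

ℤ→ℚ : ℤ → ℚ
ℤ→ℚ z = z ℚ./ 1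

-- rational division; the value for q = 0 is a junk value never used
qdiv : ℚ → ℚ → ℚ
qdiv p q with q ≟ 0ℚ
... | yes _ = 0ℚ
... | no q≢0 = _÷_ p q {{≢-nonZero q≢0}}

-- natural division; the value for divisor 0 is a junk value never used
divN : ℕ → ℕ → ℕ
divN m zero = 0
divN m (suc k) = m DM./ suc k

-- rho(x_1,...,x_k) = x_1...x_k - x_2...x_k + ... + (-1)^(k-1) x_k + (-1)^k
productℤ : List ℤ → ℤ
productℤ = foldr ℤ._*_ (ℤ.+ 1)

sumℤ : List ℤ → ℤ
sumℤ = foldr ℤ._+_ (ℤ.+ 0)

ρ : List ℤ → ℤ
ρ xs = sumℤ (map (λ i → sgn i ℤ.* productℤ (drop i xs)) (upTo (length xs)))
       ℤ.+ sgn (length xs)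

revA : (ℕ → ℕ) → ℕ → List ℤ
revA a zero = []
revA a (suc k) = (+ a (suc k)) ∷ revA a k

prod1 : (ℕ → ℕ) → ℕ → ℕ
prod1 f zero = 1
prod1 f (suc j) = f (suc j) ℕ.* prod1 f j

prod1ℚ : (ℕ → ℚ) → ℕ → ℚ
prod1ℚ f zero = 1ℚ
prod1ℚ f (suc j) = f (suc j) ℚ.* prod1ℚ f j

-- A root of unity e^{2 pi i θ} is represented by an angle θ : ℚ, two angles
-- denoting the same root of unity iff θ - θ' is an integer.
-- An element of the group ring is a finite formal sum Σ c <e^{2 pi i θ}>,
-- represented by a list of (coefficient c , angle θ); two elements are equal
-- iff they have the same coefficient at every root of unity.

GR : Set
GR = List (ℚ × ℚ)

coeff : GR → ℚ → ℚ
coeff [] θ = 0ℚ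
coeff ((c , φ) ∷ x) θ with ↧ₙ (φ ℚ.- θ) ℕ.≟ 1
... | yes _ = c ℚ.+ coeff x θ
... | no _ = coeff x θ

infix 4 _≈GR_
_≈GR_ : GR → GR → Set
x ≈GR y = ∀ θ → coeff x θ ≡ coeff y θ

⟨_⟩ : ℚ → GR
⟨ θ ⟩ = (1ℚ , θ) ∷ []

0GR : GR
0GR = []

1GR : GR
1GR = ⟨ 0ℚ ⟩

infixl 6 _+GR_
_+GR_ : GR → GR → GR
x +GR y = x ++ y

infixl 7 _·GR_
_·GR_ : ℚ → GR → GR
c ·GR x = map (λ p → (c ℚ.* proj₁ p , proj₂ p)) x

infixl 7 _*GR_
_*GR_ : GR → GR → GR
x *GR y = concatMap (λ p → map (λ q → (proj₁ p ℚ.* proj₁ q , proj₂ p ℚ.+ proj₂ q)) y) x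

infixl 6 _-GR_
_-GR_ : GR → GR → GR
x -GR y = x +GR (ℚ.- 1ℚ) ·GR y

Λ : ℕ → GR
Λ zero = []
Λ (suc k) = map (λ a → (1ℚ , (+ a) ℚ./ suc k)) (upTo (suc k))

-- E_m = (1/m) Λ_m   (m ≥ 1; E 0 is a junk value never used)
E : ℕ → GR
E zero = []
E (suc k) = ((+ 1) ℚ./ suc k) ·GR Λ (suc k)

prodGR : (ℕ → GR) → ℕ → GR
prodGR f zero = 1GR
prodGR f (suc n) = prodGR f n *GR f (suc n)

sumGR : (ℕ → GR) → ℕ → GR
sumGR f zero = 0GR
sumGR f (suc n) = sumGR f n +GR f (suc n)

IsSeq : (n : ℕ) (a : ℕ → ℕ) (s0 t0 : ℕ) → (ℕ → ℚ) → Set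
IsSeq n a s0 t0 w =
  (w 0 ≡ qdiv (ℕ→ℚ s0) (ℕ→ℚ t0)) ×
  (∀ j → 1 ≤ j → j ≤ n →
     (0ℚ ℚ.< w j) × (w j ℚ.< 1ℚ) × (ℕ→ℚ (a j) ℚ.* w j ℚ.+ w (j ∸ 1) ≡ 1ℚ))

sOf : ℕ → (ℕ → ℚ) → ℕ → ℕ
sOf s0 w zero = s0
sOf s0 w (suc j) = ℤ.∣ ↥ w (suc j) ∣

tOf : ℕ → (ℕ → ℚ) → ℕ → ℕ
tOf t0 w zero = t0
tOf t0 w (suc j) = ↧ₙ w (suc j)

βOf : (ℕ → ℕ) → ℕ → ℕ → (ℕ → ℚ) → ℕ → ℕ
βOf a s0 t0 w j = gcd (tOf t0 w (j ∸ 1) ∸ sOf s0 w (j ∸ 1)) (a j)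

αOf : (ℕ → ℕ) → ℕ → ℕ → (ℕ → ℚ) → ℕ → ℕ
αOf a s0 t0 w j = divN (a j) (βOf a s0 t0 w j)

-- 1/m for a positive natural m (junk value 0 for m = 0, never used)
invN : ℕ → ℚ
invN m = qdiv 1ℚ (ℕ→ℚ m)

module Submission where

-- Number theory.  w_{j+1} = (t_j - s_j)/(a_{j+1} t_j), and since t_j - s_j is
-- coprime to t_j the cancelled factor is β_{j+1} = gcd(t_j - s_j, a_{j+1}):
-- s_{j+1} β_{j+1} = t_j - s_j and t_{j+1} β_{j+1} = a_{j+1} t_j.  Induction with
-- ρ(a_{j+1},...,a_1) = a_{j+1}...a_1 - ρ(a_j,...,a_1) gives the defect identity
-- β_j...β_1 (t_j - s_j) = ρ(a_j,...,a_1) t_0 - (-1)^j s_0, hence s_j and t_j.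
--
-- Elements are compared by coefficients; Λ_m has coefficient 1
-- at θ iff mθ ∈ ℤ, so it absorbs m-th roots of unity.  As t_1 | t_2 | ..., the
-- product P_k = Π_{j≤k} (Λ_{t_j}/s_j - Λ_1) satisfies P_k Λ_{t_{k+1}} =
-- ε(P_k) Λ_{t_{k+1}} (ε = augmentation), giving an alternating recursion for
-- P_k.  With ε(P_k)(t_0 - s_0) = β_k...β_1 (t_k - s_k) this yields the first
-- two identities; the third is Π (1/w_j - 1) = ε(P_n) plus the defect identity.

open import Defs
open import Data.Nat as ℕ using (ℕ; zero; suc; _∸_; _≤_; _<_; z≤n; s≤s)
import Data.Nat.Properties as ℕP
import Data.Nat.DivMod as ℕDM
import Data.Nat.Solver as ℕS
open import Data.Nat.Divisibility using (_∣_; divides; ∣-refl; ∣-trans; ∣m+n∣m⇒∣n; m∣m*n; ∣-antisym)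
open import Data.Nat.GCD using (gcd; gcd[m,n]∣m; gcd[m,n]∣n; gcd-greatest)
open import Data.Nat.Coprimality as Coprimality using (Coprime; coprime-divisor; gcd≡1⇒coprime)
open import Data.Integer as ℤ using (ℤ; +_)
import Data.Integer.Properties as ℤP
import Data.Integer.GCD as ℤGCD
import Data.Integer.DivMod as ℤDM
import Data.Integer.Solver as ℤS
open import Data.Rational as ℚ using (ℚ; 0ℚ; 1ℚ; mkℚ; ↥_; ↧_; ↧ₙ_; _+_; _*_; _-_; -_; 1/_; _/_; toℚᵘ)
open import Data.Rational.Properties as ℚP using (_≟_)
import Data.Rational.Unnormalised as ℚᵘ
import Data.Rational.Unnormalised.Properties as ℚᵘP
import Data.Rational.Solver as ℚS
import Algebra.Properties.Group ℚP.+-0-group as ℚ+Group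
open import Data.List using ([]; _∷_; _++_; map; upTo; applyUpTo; drop; length)
import Data.List.Properties as ListP
open import Data.Product using (_×_; _,_; proj₁; proj₂; ∃)
open import Data.Sum using (inj₁; inj₂)
open import Relation.Binary.PropositionalEquality
open import Relation.Nullary using (Dec; yes; no; ¬_)
open import Data.Empty using (⊥-elim)
open import Function using (_∘_)

ι : ℤ → ℚ
ι = ℤ→ℚ

↥ι : ∀ z → ↥ (ι z) ≡ z
↥ι z = trans (sym (ℤP.*-identityʳ _)) (trans (cong (↥ (ι z) ℤ.*_) (sym (ℤGCD.gcd-zeroʳ z))) (ℚP.↥-/ z 1))

↧ι : ∀ z → ↧ (ι z) ≡ + 1
↧ι z = trans (sym (ℤP.*-identityʳ _)) (trans (cong (↧ (ι z) ℤ.*_) (sym (ℤGCD.gcd-zeroʳ z))) (ℚP.↧-/ z 1))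

-- ι z is the unnormalised fraction z/1; the homomorphism laws are
-- transported through the injective map toℚᵘ.
ι-toℚᵘ : ∀ z → toℚᵘ (ι z) ℚᵘ.≃ ℚᵘ.mkℚᵘ z 0
ι-toℚᵘ z = ℚᵘ.*≡* (cong₂ ℤ._*_ (trans (ℚP.↥ᵘ-toℚᵘ (ι z)) (↥ι z)) (sym (trans (ℚP.↧ᵘ-toℚᵘ (ι z)) (↧ι z))))

ι-+ : ∀ a b → ι (a ℤ.+ b) ≡ ι a + ι b
ι-+ a b = ℚP.toℚᵘ-injective (ℚᵘP.≃-trans (ι-toℚᵘ (a ℤ.+ b)) (ℚᵘP.≃-sym
  (ℚᵘP.≃-trans (ℚP.toℚᵘ-homo-+ (ι a) (ι b)) (ℚᵘP.≃-trans (ℚᵘP.+-cong (ι-toℚᵘ a) (ι-toℚᵘ b)) (ℚᵘ.*≡* (cross a b))))))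
  where
  open ℤS.+-*-Solver
  cross : ∀ a b → (a ℤ.* + 1 ℤ.+ b ℤ.* + 1) ℤ.* + 1 ≡ (a ℤ.+ b) ℤ.* (+ 1 ℤ.* + 1)
  cross = solve 2 (λ a b → (a :* con (+ 1) :+ b :* con (+ 1)) :* con (+ 1) := (a :+ b) :* (con (+ 1) :* con (+ 1))) refl

ι-* : ∀ a b → ι (a ℤ.* b) ≡ ι a * ι b
ι-* a b = ℚP.toℚᵘ-injective (ℚᵘP.≃-trans (ι-toℚᵘ (a ℤ.* b)) (ℚᵘP.≃-sym
  (ℚᵘP.≃-trans (ℚP.toℚᵘ-homo-* (ι a) (ι b)) (ℚᵘP.≃-trans (ℚᵘP.*-cong (ι-toℚᵘ a) (ι-toℚᵘ b)) (ℚᵘ.*≡* refl)))))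

ι-neg : ∀ a → ι (ℤ.- a) ≡ - ι a
ι-neg a = ℚP.toℚᵘ-injective (ℚᵘP.≃-trans (ι-toℚᵘ (ℤ.- a)) (ℚᵘP.≃-sym
  (ℚᵘP.≃-trans (ℚP.toℚᵘ-homo‿- (ι a)) (ℚᵘP.≃-trans (ℚᵘP.-‿cong (ι-toℚᵘ a)) (ℚᵘ.*≡* refl)))))

ι-- : ∀ a b → ι (a ℤ.- b) ≡ ι a - ι b
ι-- a b = trans (ι-+ a (ℤ.- b)) (cong (λ u → ι a + u) (ι-neg b))

ι-injective : ∀ {a b} → ι a ≡ ι b → a ≡ b
ι-injective {a} {b} e = trans (sym (↥ι a)) (trans (cong ↥_ e) (↥ι b))

ι≢0 : ∀ {a} → a ≢ + 0 → ι a ≢ 0ℚ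
ι≢0 a≢0 e = a≢0 (ι-injective e)

ι-mono-< : ∀ {a b} → a ℤ.< b → ι a ℚ.< ι b
ι-mono-< {a} {b} a<b = ℚ.*<* (subst₂ ℤ._<_ (sym (cong₂ ℤ._*_ (↥ι a) (↧ι b))) (sym (cong₂ ℤ._*_ (↥ι b) (↧ι a)))
  (subst₂ ℤ._<_ (sym (ℤP.*-identityʳ a)) (sym (ℤP.*-identityʳ b)) a<b))

ι-mono-≤ : ∀ {a b} → a ℤ.≤ b → ι a ℚ.≤ ι b
ι-mono-≤ {a} {b} a≤b = ℚ.*≤* (subst₂ ℤ._≤_ (sym (cong₂ ℤ._*_ (↥ι a) (↧ι b))) (sym (cong₂ ℤ._*_ (↥ι b) (↧ι a)))
  (subst₂ ℤ._≤_ (sym (ℤP.*-identityʳ a)) (sym (ℤP.*-identityʳ b)) a≤b))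

ιℕ-* : ∀ x y → ι (+ (x ℕ.* y)) ≡ ι (+ x) * ι (+ y)
ιℕ-* x y = trans (cong ι (ℤP.pos-* x y)) (ι-* (+ x) (+ y))

+-∸ : ∀ m n → n ≤ m → + (m ∸ n) ≡ + m ℤ.- + n
+-∸ m n n≤m = sym (trans (ℤP.m-n≡m⊖n m n) (ℤP.⊖-≥ n≤m))

ιℕ-∸ : ∀ x y → y ≤ x → ι (+ (x ∸ y)) ≡ ι (+ x) - ι (+ y)
ιℕ-∸ x y y≤x = trans (cong ι (+-∸ x y y≤x)) (ι-- (+ x) (+ y))

ιℕ≢0 : ∀ {m} → 1 ≤ m → ι (+ m) ≢ 0ℚ
ιℕ≢0 {suc m} _ = ι≢0 {+ suc m} λ ()

/-*-cancel : ∀ z k → (z / suc k) * ι (+ suc k) ≡ ι z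
/-*-cancel z k = ℚP.toℚᵘ-injective (ℚᵘP.≃-trans (ℚP.toℚᵘ-homo-* (z / suc k) (ι (+ suc k)))
  (ℚᵘP.≃-trans (ℚᵘP.*-cong (ℚP.toℚᵘ-fromℚᵘ (ℚᵘ.mkℚᵘ z k)) (ι-toℚᵘ (+ suc k)))
  (ℚᵘP.≃-trans (ℚᵘ.*≡* (cross z (+ suc k))) (ℚᵘP.≃-sym (ι-toℚᵘ z)))))
  where
  open ℤS.+-*-Solver
  cross : ∀ z m → (z ℤ.* m) ℤ.* + 1 ≡ z ℤ.* (m ℤ.* + 1)
  cross = solve 2 (λ z m → (z :* m) :* con (+ 1) := z :* (m :* con (+ 1))) refl

*-cancelʳ-≢0 : ∀ {x y q} → q ≢ 0ℚ → x * q ≡ y * q → x ≡ y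
*-cancelʳ-≢0 {x} {y} {q} q≢0 e = begin
  x                 ≡⟨ sym (ℚP.*-identityʳ x) ⟩
  x * 1ℚ            ≡⟨ cong (x *_) (sym (ℚP.*-inverseʳ q)) ⟩
  x * (q * 1/ q)    ≡⟨ sym (ℚP.*-assoc x q _) ⟩
  x * q * 1/ q      ≡⟨ cong (_* 1/ q) e ⟩
  y * q * 1/ q      ≡⟨ ℚP.*-assoc y q _ ⟩
  y * (q * 1/ q)    ≡⟨ cong (y *_) (ℚP.*-inverseʳ q) ⟩
  y * 1ℚ            ≡⟨ ℚP.*-identityʳ y ⟩
  y                 ∎
  where
  open ≡-Reasoning
  instance
    q-nonZero : ℚ.NonZero q
    q-nonZero = ℚ.≢-nonZero q≢0

qdiv-* : ∀ p q → q ≢ 0ℚ → qdiv p q * q ≡ p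
qdiv-* p q q≢0 with q ≟ 0ℚ
... | yes q≡0 = ⊥-elim (q≢0 q≡0)
... | no q≢0′ = trans (ℚP.*-assoc p _ q) (trans (cong (p *_) (ℚP.*-inverseˡ q {{ℚ.≢-nonZero q≢0′}})) (ℚP.*-identityʳ p))

qdiv-unique : ∀ {p q x} → q ≢ 0ℚ → x * q ≡ p → qdiv p q ≡ x
qdiv-unique {p} {q} q≢0 e = *-cancelʳ-≢0 q≢0 (trans (qdiv-* p q q≢0) (sym e))

-- Indicator of the integers: coeff tests whether two angles agree mod ℤ.
intInd : ℚ → ℚ
intInd r with ↧ₙ r ℕ.≟ 1
... | yes _ = 1ℚ
... | no _ = 0ℚ

coeff-∷ : ∀ c φ x θ → coeff ((c , φ) ∷ x) θ ≡ c * intInd (φ - θ) + coeff x θ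
coeff-∷ c φ x θ with ↧ₙ (φ - θ) ℕ.≟ 1
... | yes _ = cong (λ u → u + coeff x θ) (sym (ℚP.*-identityʳ c))
... | no _ = trans (sym (ℚP.+-identityˡ _)) (cong (λ u → u + coeff x θ) (sym (ℚP.*-zeroʳ c)))

coeff-+GR : ∀ x y θ → coeff (x +GR y) θ ≡ coeff x θ + coeff y θ
coeff-+GR [] y θ = sym (ℚP.+-identityˡ _)
coeff-+GR ((c , φ) ∷ x) y θ = begin
  coeff ((c , φ) ∷ (x ++ y)) θ              ≡⟨ coeff-∷ c φ (x ++ y) θ ⟩
  m + coeff (x ++ y) θ                      ≡⟨ cong (λ u → m + u) (coeff-+GR x y θ) ⟩
  m + (coeff x θ + coeff y θ)               ≡⟨ sym (ℚP.+-assoc m (coeff x θ) (coeff y θ)) ⟩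
  m + coeff x θ + coeff y θ                 ≡⟨ cong (λ u → u + coeff y θ) (sym (coeff-∷ c φ x θ)) ⟩
  coeff ((c , φ) ∷ x) θ + coeff y θ         ∎
  where
  open ≡-Reasoning
  m : ℚ
  m = c * intInd (φ - θ)

coeff-·GR : ∀ d x θ → coeff (d ·GR x) θ ≡ d * coeff x θ
coeff-·GR d [] θ = sym (ℚP.*-zeroʳ d)
coeff-·GR d ((c , φ) ∷ x) θ = begin
  coeff ((d * c , φ) ∷ (d ·GR x)) θ         ≡⟨ coeff-∷ (d * c) φ (d ·GR x) θ ⟩
  d * c * i + coeff (d ·GR x) θ             ≡⟨ cong (λ u → d * c * i + u) (coeff-·GR d x θ) ⟩
  d * c * i + d * coeff x θ                 ≡⟨ cong (λ u → u + d * coeff x θ) (ℚP.*-assoc d c i) ⟩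
  d * (c * i) + d * coeff x θ               ≡⟨ sym (ℚP.*-distribˡ-+ d (c * i) (coeff x θ)) ⟩
  d * (c * i + coeff x θ)                   ≡⟨ cong (d *_) (sym (coeff-∷ c φ x θ)) ⟩
  d * coeff ((c , φ) ∷ x) θ                 ∎
  where
  open ≡-Reasoning
  i : ℚ
  i = intInd (φ - θ)

-- Convolution of an element x with a coefficient function f:
-- (x ⋆ f)(θ) = Σ_{(c,φ) ∈ x} c f(θ - φ), so that coeff (x y) = x ⋆ coeff y.
conv : GR → (ℚ → ℚ) → ℚ → ℚ
conv [] f θ = 0ℚ
conv ((c , φ) ∷ x) f θ = c * f (θ - φ) + conv x f θ

-- The summand of x *GR y coming from the term c⟨φ⟩ of x.
scaleShift : ℚ → ℚ → GR → GR
scaleShift c φ = map (λ q → (c * proj₁ q , φ + proj₂ q))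

coeff-scaleShift : ∀ c φ y θ → coeff (scaleShift c φ y) θ ≡ c * coeff y (θ - φ)
coeff-scaleShift c φ [] θ = sym (ℚP.*-zeroʳ c)
coeff-scaleShift c φ ((d , ψ) ∷ y) θ = begin
  coeff ((c * d , φ + ψ) ∷ scaleShift c φ y) θ             ≡⟨ coeff-∷ (c * d) (φ + ψ) (scaleShift c φ y) θ ⟩
  c * d * intInd (φ + ψ - θ) + coeff (scaleShift c φ y) θ  ≡⟨ cong₂ _+_ (cong (λ r → c * d * intInd r) (shift φ ψ θ)) (coeff-scaleShift c φ y θ) ⟩
  c * d * i + c * coeff y (θ - φ)                          ≡⟨ cong (λ u → u + c * coeff y (θ - φ)) (ℚP.*-assoc c d i) ⟩
  c * (d * i) + c * coeff y (θ - φ)                        ≡⟨ sym (ℚP.*-distribˡ-+ c (d * i) (coeff y (θ - φ))) ⟩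
  c * (d * i + coeff y (θ - φ))                            ≡⟨ cong (c *_) (sym (coeff-∷ d ψ y (θ - φ))) ⟩
  c * coeff ((d , ψ) ∷ y) (θ - φ)                          ∎
  where
  open ≡-Reasoning
  i : ℚ
  i = intInd (ψ - (θ - φ))
  shift : ∀ φ ψ θ → φ + ψ - θ ≡ ψ - (θ - φ)
  shift = solve 3 (λ φ ψ θ → φ :+ ψ :- θ := ψ :- (θ :- φ)) refl
    where open ℚS.+-*-Solver

coeff-*GR : ∀ x y θ → coeff (x *GR y) θ ≡ conv x (coeff y) θ
coeff-*GR [] y θ = refl
coeff-*GR ((c , φ) ∷ x) y θ =
  trans (coeff-+GR (scaleShift c φ y) (x *GR y) θ) (cong₂ _+_ (coeff-scaleShift c φ y θ) (coeff-*GR x y θ))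

conv-cong : ∀ x {f g} θ → (∀ r → f r ≡ g r) → conv x f θ ≡ conv x g θ
conv-cong [] θ e = refl
conv-cong ((c , φ) ∷ x) θ e = cong₂ _+_ (cong (c *_) (e (θ - φ))) (conv-cong x θ e)

conv-linear : ∀ x f g a b θ → conv x (λ r → a * f r + b * g r) θ ≡ a * conv x f θ + b * conv x g θ
conv-linear [] f g a b θ = solve 2 (λ a b → con 0ℚ := a :* con 0ℚ :+ b :* con 0ℚ) refl a b
  where open ℚS.+-*-Solver
conv-linear ((c , φ) ∷ x) f g a b θ =
  trans (cong (λ u → c * (a * f (θ - φ) + b * g (θ - φ)) + u) (conv-linear x f g a b θ))
        (regroup c a b (f (θ - φ)) (g (θ - φ)) (conv x f θ) (conv x g θ))
  where
  open ℚS.+-*-Solver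
  regroup : ∀ c a b F G X Y → c * (a * F + b * G) + (a * X + b * Y) ≡ a * (c * F + X) + b * (c * G + Y)
  regroup = solve 7 (λ c a b F G X Y → c :* (a :* F :+ b :* G) :+ (a :* X :+ b :* Y) := a :* (c :* F :+ X) :+ b :* (c :* G :+ Y)) refl

mass : GR → ℚ
mass [] = 0ℚ
mass ((c , φ) ∷ x) = c + mass x

mass-+GR : ∀ x y → mass (x +GR y) ≡ mass x + mass y
mass-+GR [] y = sym (ℚP.+-identityˡ _)
mass-+GR ((c , φ) ∷ x) y = trans (cong (λ u → c + u) (mass-+GR x y)) (sym (ℚP.+-assoc c (mass x) (mass y)))

mass-·GR : ∀ d x → mass (d ·GR x) ≡ d * mass x
mass-·GR d [] = sym (ℚP.*-zeroʳ d)
mass-·GR d ((c , φ) ∷ x) = trans (cong (λ u → d * c + u) (mass-·GR d x)) (sym (ℚP.*-distribˡ-+ d c (mass x)))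

mass-scaleShift : ∀ c φ y → mass (scaleShift c φ y) ≡ c * mass y
mass-scaleShift c φ [] = sym (ℚP.*-zeroʳ c)
mass-scaleShift c φ ((d , ψ) ∷ y) = trans (cong (λ u → c * d + u) (mass-scaleShift c φ y)) (sym (ℚP.*-distribˡ-+ c d (mass y)))

mass-*GR : ∀ x y → mass (x *GR y) ≡ mass x * mass y
mass-*GR [] y = sym (ℚP.*-zeroˡ (mass y))
mass-*GR ((c , φ) ∷ x) y =
  trans (mass-+GR (scaleShift c φ y) (x *GR y))
  (trans (cong₂ _+_ (mass-scaleShift c φ y) (mass-*GR x y)) (sym (ℚP.*-distribʳ-+ (mass y) c (mass x))))

data AllAngles (P : ℚ → Set) : GR → Set where
  [] : AllAngles P []
  _∷_ : ∀ {c φ x} → P φ → AllAngles P x → AllAngles P ((c , φ) ∷ x)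

AllAngles-+GR : ∀ {P x y} → AllAngles P x → AllAngles P y → AllAngles P (x +GR y)
AllAngles-+GR [] py = py
AllAngles-+GR (p ∷ px) py = p ∷ AllAngles-+GR px py

AllAngles-·GR : ∀ {P} c {x} → AllAngles P x → AllAngles P (c ·GR x)
AllAngles-·GR c [] = []
AllAngles-·GR c (p ∷ px) = p ∷ AllAngles-·GR c px

-- Angles of a product are sums of angles; P closed under + suffices.
AllAngles-*GR : ∀ {P : ℚ → Set} {x y} → (∀ {φ ψ} → P φ → P ψ → P (φ + ψ)) →
                AllAngles P x → AllAngles P y → AllAngles P (x *GR y)
AllAngles-*GR closed [] py = []
AllAngles-*GR {P} {x = (c , φ) ∷ _} closed (p ∷ px) py = AllAngles-+GR (shifted py) (AllAngles-*GR closed px py)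
  where
  shifted : ∀ {y} → AllAngles P y → AllAngles P (scaleShift c φ y)
  shifted [] = []
  shifted (q ∷ qs) = closed p q ∷ shifted qs

conv-invariant : ∀ x f θ → AllAngles (λ φ → f (θ - φ) ≡ f θ) x → conv x f θ ≡ mass x * f θ
conv-invariant [] f θ [] = sym (ℚP.*-zeroˡ (f θ))
conv-invariant ((c , φ) ∷ x) f θ (p ∷ ps) =
  trans (cong₂ _+_ (cong (c *_) p) (conv-invariant x f θ ps)) (sym (ℚP.*-distribʳ-+ _ c (mass x)))

conv-Λ1 : ∀ x θ → conv x (coeff (Λ 1)) θ ≡ coeff x θ
conv-Λ1 [] θ = refl
conv-Λ1 ((c , φ) ∷ x) θ = trans (cong₂ _+_ (cong (c *_) unit) (conv-Λ1 x θ)) (sym (coeff-∷ c φ x θ))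
  where
  open ℚS.+-*-Solver
  flip : 0ℚ - (θ - φ) ≡ φ - θ
  flip = solve 2 (λ φ θ → con 0ℚ :- (θ :- φ) := φ :- θ) refl φ θ
  unit : coeff (Λ 1) (θ - φ) ≡ intInd (φ - θ)
  unit = trans (coeff-∷ 1ℚ 0ℚ [] (θ - φ)) (trans (ℚP.+-identityʳ _) (trans (ℚP.*-identityˡ _) (cong intInd flip)))

sum₁ : ℕ → (ℕ → ℚ) → ℚ
sum₁ zero f = 0ℚ
sum₁ (suc k) f = sum₁ k f + f (suc k)

coeff-sumGR : ∀ g k θ → coeff (sumGR g k) θ ≡ sum₁ k (λ j → coeff (g j) θ)
coeff-sumGR g zero θ = refl
coeff-sumGR g (suc k) θ = trans (coeff-+GR (sumGR g k) (g (suc k)) θ) (cong (λ u → u + coeff (g (suc k)) θ) (coeff-sumGR g k θ))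

sum₁-cong : ∀ k {f g} → (∀ j → 1 ≤ j → j ≤ k → f j ≡ g j) → sum₁ k f ≡ sum₁ k g
sum₁-cong zero h = refl
sum₁-cong (suc k) h = cong₂ _+_ (sum₁-cong k (λ j 1≤j j≤k → h j 1≤j (ℕP.m≤n⇒m≤1+n j≤k))) (h (suc k) (s≤s z≤n) ℕP.≤-refl)

sum₁-neg : ∀ k f → sum₁ k (λ j → - f j) ≡ - sum₁ k f
sum₁-neg zero f = refl
sum₁-neg (suc k) f = trans (cong (λ u → u + - f (suc k)) (sum₁-neg k f)) (sym (ℚP.neg-distrib-+ (sum₁ k f) (f (suc k))))

coeff-combination : ∀ (c₀ : ℚ) (x : GR) (k : ℕ → ℚ) (y : ℕ → GR) n θ →
  coeff (c₀ ·GR x +GR sumGR (λ j → k j ·GR y j) n) θ ≡ c₀ * coeff x θ + sum₁ n (λ j → k j * coeff (y j) θ)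
coeff-combination c₀ x k y n θ =
  trans (coeff-+GR (c₀ ·GR x) (sumGR (λ j → k j ·GR y j) n) θ)
        (cong₂ _+_ (coeff-·GR c₀ x θ) (trans (coeff-sumGR (λ j → k j ·GR y j) n θ) (sum₁-cong n λ j _ _ → coeff-·GR (k j) (y j) θ)))

IsInt : ℚ → Set
IsInt r = ∃ λ z → r ≡ ι z

denominator-one : ∀ r → ↧ₙ r ≡ 1 → r ≡ ι (↥ r)
denominator-one r@(mkℚ n zero _) _ = sym (ℚP.↥p/↧p≡p r)

isInt? : ∀ r → Dec (IsInt r)
isInt? r with ↧ₙ r ℕ.≟ 1
... | yes e = yes (↥ r , denominator-one r e)
... | no ne = no λ { (z , e) → ne (trans (cong ↧ₙ_ e) (ℤP.+-injective (↧ι z))) }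

intInd-int : ∀ {r} → IsInt r → intInd r ≡ 1ℚ
intInd-int {r} (z , e) with ↧ₙ r ℕ.≟ 1
... | yes _ = refl
... | no ne = ⊥-elim (ne (trans (cong ↧ₙ_ e) (ℤP.+-injective (↧ι z))))

intInd-nonint : ∀ {r} → ¬ IsInt r → intInd r ≡ 0ℚ
intInd-nonint {r} h with ↧ₙ r ℕ.≟ 1
... | yes e = ⊥-elim (h (↥ r , denominator-one r e))
... | no _ = refl

intInd-shift : ∀ r z → intInd (r - ι z) ≡ intInd r
intInd-shift r z with isInt? r
... | yes (c , r≡c) = trans (intInd-int (c ℤ.- z , trans (cong (_- ι z) r≡c) (sym (ι-- c z)))) (sym (intInd-int (c , r≡c)))
... | no ¬int = trans (intInd-nonint λ { (y , e) → ¬int (y ℤ.+ z , back {y} e) }) (sym (intInd-nonint ¬int))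
  where
  back : ∀ {y} → r - ι z ≡ ι y → r ≡ ι (y ℤ.+ z)
  back {y} e = trans (solve 2 (λ r u → r := r :- u :+ u) refl r (ι z)) (trans (cong (_+ ι z) e) (sym (ι-+ y z)))
    where open ℚS.+-*-Solver

units : (ℕ → ℚ) → ℕ → GR
units g n = applyUpTo (λ a → (1ℚ , g a)) n

Λ-units : ∀ k → Λ (suc k) ≡ units (λ a → + a / suc k) (suc k)
Λ-units k = ListP.map-upTo _ (suc k)

coeff-units-none : ∀ g n θ → (∀ a → a < n → ¬ IsInt (g a - θ)) → coeff (units g n) θ ≡ 0ℚ
coeff-units-none g zero θ h = refl
coeff-units-none g (suc n) θ h = begin
  coeff (units g (suc n)) θ                              ≡⟨ coeff-∷ 1ℚ (g 0) _ θ ⟩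
  1ℚ * intInd (g 0 - θ) + coeff (units (g ∘ suc) n) θ    ≡⟨ cong₂ (λ u v → 1ℚ * u + v) (intInd-nonint (h 0 (s≤s z≤n)))
                                                                 (coeff-units-none (g ∘ suc) n θ (λ a a<n → h (suc a) (s≤s a<n))) ⟩
  1ℚ * 0ℚ + 0ℚ                                           ≡⟨⟩
  0ℚ                                                     ∎
  where open ≡-Reasoning

coeff-units-one : ∀ g n θ r → r < n → IsInt (g r - θ) → (∀ a → a < n → a ≢ r → ¬ IsInt (g a - θ)) →
                  coeff (units g n) θ ≡ 1ℚ
coeff-units-one g (suc n) θ zero _ hit miss = begin
  coeff (units g (suc n)) θ                              ≡⟨ coeff-∷ 1ℚ (g 0) _ θ ⟩
  1ℚ * intInd (g 0 - θ) + coeff (units (g ∘ suc) n) θ    ≡⟨ cong₂ (λ u v → 1ℚ * u + v) (intInd-int hit)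
                                                                 (coeff-units-none (g ∘ suc) n θ (λ a a<n → miss (suc a) (s≤s a<n) λ ())) ⟩
  1ℚ * 1ℚ + 0ℚ                                           ≡⟨⟩
  1ℚ                                                     ∎
  where open ≡-Reasoning
coeff-units-one g (suc n) θ (suc r) r<n hit miss = begin
  coeff (units g (suc n)) θ                              ≡⟨ coeff-∷ 1ℚ (g 0) _ θ ⟩
  1ℚ * intInd (g 0 - θ) + coeff (units (g ∘ suc) n) θ    ≡⟨ cong₂ (λ u v → 1ℚ * u + v) (intInd-nonint (miss 0 (s≤s z≤n) λ ()))
                                                                 (coeff-units-one (g ∘ suc) n θ r (ℕ.s<s⁻¹ r<n) hit
                                                                    (λ a a<n a≢r → miss (suc a) (s≤s a<n) (a≢r ∘ ℕP.suc-injective))) ⟩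
  1ℚ * 0ℚ + 1ℚ                                           ≡⟨⟩
  1ℚ                                                     ∎
  where open ≡-Reasoning

residue-unique : ∀ {a r m} k → a < m → r < m → a ≡ r ℕ.+ k ℕ.* m → a ≡ r
residue-unique {a} {r} {suc m} k a<m r<m a≡ = begin
  a                             ≡⟨ sym (ℕDM.m<n⇒m%n≡m a<m) ⟩
  a ℕDM.% suc m                 ≡⟨ cong (ℕDM._% suc m) a≡ ⟩
  (r ℕ.+ k ℕ.* suc m) ℕDM.% suc m ≡⟨ ℕDM.[m+kn]%n≡m%n r k (suc m) ⟩
  r ℕDM.% suc m                 ≡⟨ ℕDM.m<n⇒m%n≡m r<m ⟩
  r                             ∎
  where open ≡-Reasoning

residue-unique-ℤ : ∀ {a r m} y → a < m → r < m → + a ℤ.- + r ≡ y ℤ.* + m → a ≡ r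
residue-unique-ℤ {a} {r} {m} (+ k) a<m r<m e =
  residue-unique k a<m r<m (ℤP.+-injective (trans (move (+ a) (+ r) (+ k ℤ.* + m) e) (sym (pos-sum r k))))
  where
  open ℤS.+-*-Solver
  move : ∀ A R Y → A ℤ.- R ≡ Y → A ≡ R ℤ.+ Y
  move A R Y e = trans (solve 2 (λ A R → A := R :+ (A :- R)) refl A R) (cong (ℤ._+_ R) e)
  pos-sum : ∀ r k → + (r ℕ.+ k ℕ.* m) ≡ + r ℤ.+ + k ℤ.* + m
  pos-sum r k = trans (ℤP.pos-+ r (k ℕ.* m)) (cong (ℤ._+_ (+ r)) (ℤP.pos-* k m))
residue-unique-ℤ {a} {r} {m} ℤ.-[1+ k ] a<m r<m e =
  sym (residue-unique (suc k) r<m a<m (ℤP.+-injective (trans (move (+ a) (+ r) e) (sym (pos-sum a (suc k))))))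
  where
  open ℤS.+-*-Solver
  move : ∀ A R → A ℤ.- R ≡ ℤ.-[1+ k ] ℤ.* + m → R ≡ A ℤ.+ + suc k ℤ.* + m
  move A R e = begin
    R                                    ≡⟨ solve 2 (λ A R → R := A :- (A :- R)) refl A R ⟩
    A ℤ.- (A ℤ.- R)                      ≡⟨ cong (λ u → A ℤ.- u) e ⟩
    A ℤ.- ℤ.-[1+ k ] ℤ.* + m             ≡⟨ cong (λ u → A ℤ.- u) (sym (ℤP.neg-distribˡ-* (+ suc k) (+ m))) ⟩
    A ℤ.- ℤ.- (+ suc k ℤ.* + m)          ≡⟨ solve 2 (λ A u → A :- (:- u) := A :+ u) refl A (+ suc k ℤ.* + m) ⟩
    A ℤ.+ + suc k ℤ.* + m                ∎
    where open ≡-Reasoning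
  pos-sum : ∀ r k → + (r ℕ.+ k ℕ.* m) ≡ + r ℤ.+ + k ℤ.* + m
  pos-sum r k = trans (ℤP.pos-+ r (k ℕ.* m)) (cong (ℤ._+_ (+ r)) (ℤP.pos-* k m))

Λ-coeff : ∀ k θ → coeff (Λ (suc k)) θ ≡ intInd (ι (+ suc k) * θ)
Λ-coeff k θ = trans (cong (λ L → coeff L θ) (Λ-units k)) (by-cases (isInt? (M * θ)))
  where
  m : ℕ
  m = suc k
  M : ℚ
  M = ι (+ m)
  g : ℕ → ℚ
  g a = + a / m
  M≢0 : M ≢ 0ℚ
  M≢0 = ιℕ≢0 {m} (s≤s z≤n)
  offset : ∀ a → (g a - θ) * M ≡ ι (+ a) - M * θ
  offset a = trans (solve 3 (λ G θ M → (G :- θ) :* M := G :* M :- M :* θ) refl (g a) θ M)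
                   (cong (_- M * θ) (/-*-cancel (+ a) k))
    where open ℚS.+-*-Solver
  solve-for-mθ : ∀ a z → g a - θ ≡ ι z → M * θ ≡ ι (+ a ℤ.- z ℤ.* + m)
  solve-for-mθ a z e = begin
    M * θ                          ≡⟨ solve 2 (λ A X → X := A :- (A :- X)) refl (ι (+ a)) (M * θ) ⟩
    ι (+ a) - (ι (+ a) - M * θ)    ≡⟨ cong (λ u → ι (+ a) - u) (sym (offset a)) ⟩
    ι (+ a) - (g a - θ) * M        ≡⟨ cong (λ u → ι (+ a) - u * M) e ⟩
    ι (+ a) - ι z * M              ≡⟨ cong (λ u → ι (+ a) - u) (sym (ι-* z (+ m))) ⟩
    ι (+ a) - ι (z ℤ.* + m)        ≡⟨ sym (ι-- (+ a) (z ℤ.* + m)) ⟩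
    ι (+ a ℤ.- z ℤ.* + m)          ∎
    where
    open ≡-Reasoning
    open ℚS.+-*-Solver
  by-cases : Dec (IsInt (M * θ)) → coeff (units g m) θ ≡ intInd (M * θ)
  by-cases (no ¬int) =
    trans (coeff-units-none g m θ λ { a _ (z , e) → ¬int (+ a ℤ.- z ℤ.* + m , solve-for-mθ a z e) }) (sym (intInd-nonint ¬int))
  by-cases (yes (c , mθ≡c)) = trans (coeff-units-one g m θ r r<m hit miss) (sym (intInd-int (c , mθ≡c)))
    where
    open ℤS.+-*-Solver
    r : ℕ
    r = c ℤDM.%ℕ m
    q : ℤ
    q = c ℤDM./ℕ m
    r<m : r < m
    r<m = ℤDM.n%ℕd<d c m
    c≡ : c ≡ + r ℤ.+ q ℤ.* + m
    c≡ = ℤDM.a≡a%ℕn+[a/ℕn]*n c m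
    hit : IsInt (g r - θ)
    hit = ℤ.- q , *-cancelʳ-≢0 M≢0 (begin
      (g r - θ) * M                  ≡⟨ offset r ⟩
      ι (+ r) - M * θ                ≡⟨ cong (λ u → ι (+ r) - u) mθ≡c ⟩
      ι (+ r) - ι c                  ≡⟨ sym (ι-- (+ r) c) ⟩
      ι (+ r ℤ.- c)                  ≡⟨ cong (λ u → ι (+ r ℤ.- u)) c≡ ⟩
      ι (+ r ℤ.- (+ r ℤ.+ q ℤ.* + m)) ≡⟨ cong ι (solve 3 (λ R Q M → R :- (R :+ Q :* M) := (:- Q) :* M) refl (+ r) q (+ m)) ⟩
      ι (ℤ.- q ℤ.* + m)              ≡⟨ ι-* (ℤ.- q) (+ m) ⟩
      ι (ℤ.- q) * M                  ∎)
      where open ≡-Reasoning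
    miss : ∀ a → a < m → a ≢ r → ¬ IsInt (g a - θ)
    miss a a<m a≢r (z , e) = a≢r (residue-unique-ℤ (q ℤ.+ z) a<m r<m (begin
      + a ℤ.- + r                              ≡⟨ solve 3 (λ A R Zm → A :- R := (A :- Zm) :- R :+ Zm) refl (+ a) (+ r) (z ℤ.* + m) ⟩
      (+ a ℤ.- z ℤ.* + m) ℤ.- + r ℤ.+ z ℤ.* + m ≡⟨ cong (λ u → u ℤ.- + r ℤ.+ z ℤ.* + m) a-zm≡c ⟩
      (+ r ℤ.+ q ℤ.* + m) ℤ.- + r ℤ.+ z ℤ.* + m ≡⟨ solve 4 (λ R Q Z Mm → (R :+ Q :* Mm) :- R :+ Z :* Mm := (Q :+ Z) :* Mm) refl (+ r) q z (+ m) ⟩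
      (q ℤ.+ z) ℤ.* + m                        ∎))
      where
      open ≡-Reasoning
      a-zm≡c : + a ℤ.- z ℤ.* + m ≡ + r ℤ.+ q ℤ.* + m
      a-zm≡c = trans (ι-injective (trans (sym (solve-for-mθ a z e)) mθ≡c)) c≡
-- e^{2πiφ} is an m-th root of unity.
Root : ℕ → ℚ → Set
Root m φ = IsInt (ι (+ m) * φ)

Root-0 : ∀ m → Root m 0ℚ
Root-0 m = + 0 , ℚP.*-zeroʳ (ι (+ m))

Root-+ : ∀ {m φ ψ} → Root m φ → Root m ψ → Root m (φ + ψ)
Root-+ {m} {φ} {ψ} (a , ea) (b , eb) = a ℤ.+ b , trans (ℚP.*-distribˡ-+ (ι (+ m)) φ ψ) (trans (cong₂ _+_ ea eb) (sym (ι-+ a b)))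

Root-∣ : ∀ {d m φ} → d ∣ m → Root d φ → Root m φ
Root-∣ {d} {m} {φ} (divides q refl) (z , e) = + q ℤ.* z , (begin
  ι (+ (q ℕ.* d)) * φ       ≡⟨ cong (_* φ) (ιℕ-* q d) ⟩
  ι (+ q) * ι (+ d) * φ     ≡⟨ ℚP.*-assoc (ι (+ q)) (ι (+ d)) φ ⟩
  ι (+ q) * (ι (+ d) * φ)   ≡⟨ cong (ι (+ q) *_) e ⟩
  ι (+ q) * ι z             ≡⟨ sym (ι-* (+ q) z) ⟩
  ι (+ q ℤ.* z)             ∎)
  where open ≡-Reasoning

Λ-angles : ∀ m → AllAngles (Root m) (Λ m)
Λ-angles zero = []
Λ-angles (suc k) = subst (AllAngles (Root (suc k))) (sym (Λ-units k)) (angles (suc k) (λ a → a))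
  where
  angles : ∀ n (f : ℕ → ℕ) → AllAngles (Root (suc k)) (units (λ a → + f a / suc k) n)
  angles zero f = []
  angles (suc n) f = (+ f 0 , trans (ℚP.*-comm (ι (+ suc k)) _) (/-*-cancel (+ f 0) k)) ∷ angles n (f ∘ suc)

Λ-periodic : ∀ m → 1 ≤ m → ∀ θ φ → Root m φ → coeff (Λ m) (θ - φ) ≡ coeff (Λ m) θ
Λ-periodic (suc k) _ θ φ (z , mφ≡z) = begin
  coeff (Λ (suc k)) (θ - φ)     ≡⟨ Λ-coeff k (θ - φ) ⟩
  intInd (M * (θ - φ))          ≡⟨ cong intInd (solve 3 (λ M θ φ → M :* (θ :- φ) := M :* θ :- M :* φ) refl M θ φ) ⟩
  intInd (M * θ - M * φ)        ≡⟨ cong (λ u → intInd (M * θ - u)) mφ≡z ⟩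
  intInd (M * θ - ι z)          ≡⟨ intInd-shift (M * θ) z ⟩
  intInd (M * θ)                ≡⟨ sym (Λ-coeff k θ) ⟩
  coeff (Λ (suc k)) θ           ∎
  where
  open ≡-Reasoning
  open ℚS.+-*-Solver
  M : ℚ
  M = ι (+ suc k)

mass-units : ∀ g n → mass (units g n) ≡ ι (+ n)
mass-units g zero = refl
mass-units g (suc n) = trans (cong (λ u → 1ℚ + u) (mass-units (g ∘ suc) n)) (sym (ι-+ (+ 1) (+ n)))

mass-Λ : ∀ m → mass (Λ m) ≡ ι (+ m)
mass-Λ zero = refl
mass-Λ (suc k) = trans (cong mass (Λ-units k)) (mass-units (λ a → + a / suc k) (suc k))

invN-* : ∀ m → 1 ≤ m → invN m * ι (+ m) ≡ 1ℚ
invN-* m 1≤m = qdiv-* 1ℚ (ι (+ m)) (ιℕ≢0 1≤m)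

coeff-E : ∀ m → 1 ≤ m → ∀ θ → coeff (E m) θ ≡ invN m * coeff (Λ m) θ
coeff-E (suc k) _ θ = trans (coeff-·GR (+ 1 / suc k) (Λ (suc k)) θ) (cong (_* coeff (Λ (suc k)) θ) 1/m≡invN)
  where
  1/m≡invN : + 1 / suc k ≡ invN (suc k)
  1/m≡invN = sym (qdiv-unique (ιℕ≢0 {suc k} (s≤s z≤n)) (/-*-cancel (+ 1) k))

sgnℚ-suc : ∀ j → sgnℚ (suc j) ≡ - sgnℚ j
sgnℚ-suc j = ι-neg (sgn j)

alternating-recurrence : ∀ (x y : ℕ → ℚ) k → (∀ i → i < k → x (suc i) ≡ y (suc i) - x i) →
                         x k ≡ sgnℚ k * x 0 + sum₁ k (λ j → sgnℚ (k ∸ j) * y j)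
alternating-recurrence x y zero _ = solve 1 (λ X → X := con 1ℚ :* X :+ con 0ℚ) refl (x 0)
  where open ℚS.+-*-Solver
alternating-recurrence x y (suc k) rec = begin
  x (suc k)                                                     ≡⟨ rec k ℕP.≤-refl ⟩
  y (suc k) - x k                                               ≡⟨ cong (λ u → y (suc k) - u) (alternating-recurrence x y k (λ i i<k → rec i (ℕP.m≤n⇒m≤1+n i<k))) ⟩
  y (suc k) - (sgnℚ k * x 0 + Σ)                                ≡⟨ solve 4 (λ Y s X S → Y :- (s :* X :+ S) := (:- s) :* X :+ ((:- S) :+ con 1ℚ :* Y)) refl (y (suc k)) (sgnℚ k) (x 0) Σ ⟩
  (- sgnℚ k) * x 0 + (- Σ + 1ℚ * y (suc k))                     ≡⟨ cong₂ (λ u v → u * x 0 + (v + 1ℚ * y (suc k))) (sym (sgnℚ-suc k)) (sym shifted) ⟩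
  sgnℚ (suc k) * x 0 + (Σ′ + sgnℚ 0 * y (suc k))                ≡⟨ cong (λ i → sgnℚ (suc k) * x 0 + (Σ′ + sgnℚ i * y (suc k))) (sym (ℕP.n∸n≡0 k)) ⟩
  sgnℚ (suc k) * x 0 + sum₁ (suc k) (λ j → sgnℚ (suc k ∸ j) * y j) ∎
  where
  open ≡-Reasoning
  open ℚS.+-*-Solver
  Σ : ℚ
  Σ = sum₁ k (λ j → sgnℚ (k ∸ j) * y j)
  Σ′ : ℚ
  Σ′ = sum₁ k (λ j → sgnℚ (suc k ∸ j) * y j)
  shifted : Σ′ ≡ - Σ
  shifted = trans (sum₁-cong k λ j _ j≤k → trans (cong (λ i → sgnℚ i * y j) (ℕP.+-∸-assoc 1 j≤k))
                                             (trans (cong (_* y j) (sgnℚ-suc (k ∸ j))) (sym (ℚP.neg-distribˡ-* (sgnℚ (k ∸ j)) (y j)))))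
                  (sum₁-neg k (λ j → sgnℚ (k ∸ j) * y j))

module Expansion (n : ℕ) (c : ℕ → ℚ) (t : ℕ → ℕ)
  (t-pos : ∀ j → 1 ≤ j → j ≤ n → 1 ≤ t j)
  (t-chain : ∀ i j → 1 ≤ i → i ≤ j → j ≤ n → t i ∣ t j)
  where

  factor : ℕ → GR
  factor j = c j ·GR Λ (t j) -GR Λ 1

  P : ℕ → GR
  P = prodGR factor

  coeff-factor : ∀ j r → coeff (factor j) r ≡ c j * coeff (Λ (t j)) r + (- 1ℚ) * coeff (Λ 1) r
  coeff-factor j r = trans (coeff-+GR (c j ·GR Λ (t j)) ((- 1ℚ) ·GR Λ 1) r)
                           (cong₂ _+_ (coeff-·GR (c j) (Λ (t j)) r) (coeff-·GR (- 1ℚ) (Λ 1) r))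

  mass-factor : ∀ j → mass (factor j) ≡ c j * ι (+ t j) - 1ℚ
  mass-factor j = begin
    mass (c j ·GR Λ (t j) +GR (- 1ℚ) ·GR Λ 1)              ≡⟨ mass-+GR (c j ·GR Λ (t j)) ((- 1ℚ) ·GR Λ 1) ⟩
    mass (c j ·GR Λ (t j)) + mass ((- 1ℚ) ·GR Λ 1)         ≡⟨ cong₂ _+_ (mass-·GR (c j) (Λ (t j))) (mass-·GR (- 1ℚ) (Λ 1)) ⟩
    c j * mass (Λ (t j)) + (- 1ℚ) * mass (Λ 1)             ≡⟨ cong₂ (λ u v → c j * u + (- 1ℚ) * v) (mass-Λ (t j)) (mass-Λ 1) ⟩
    c j * ι (+ t j) + (- 1ℚ) * 1ℚ                          ≡⟨ solve 1 (λ x → x :+ (:- con 1ℚ) :* con 1ℚ := x :- con 1ℚ) refl (c j * ι (+ t j)) ⟩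
    c j * ι (+ t j) - 1ℚ                                   ∎
    where
    open ≡-Reasoning
    open ℚS.+-*-Solver

  P-angles : ∀ k → k ≤ n → ∀ m → (∀ j → 1 ≤ j → j ≤ k → t j ∣ m) → AllAngles (Root m) (P k)
  P-angles zero _ m _ = Root-0 m ∷ []
  P-angles (suc k) k<n m divs = AllAngles-*GR (Root-+ {m}) (P-angles k (ℕP.<⇒≤ k<n) m (λ j 1≤j j≤k → divs j 1≤j (ℕP.m≤n⇒m≤1+n j≤k)))
    (AllAngles-+GR (AllAngles-·GR (c (suc k)) (mapAll (Root-∣ (divs (suc k) (s≤s z≤n) ℕP.≤-refl)) (Λ-angles (t (suc k)))))
                   (AllAngles-·GR (- 1ℚ) {Λ 1} (Root-0 m ∷ [])))
    where
    mapAll : ∀ {Q R : ℚ → Set} → (∀ {φ} → Q φ → R φ) → ∀ {x} → AllAngles Q x → AllAngles R x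
    mapAll f [] = []
    mapAll f (q ∷ qs) = f q ∷ mapAll f qs

  -- Since Λ_{t_{k+1}} absorbs P_k:  P_{k+1} = c_{k+1} ε(P_k) Λ_{t_{k+1}} - P_k.
  P-step : ∀ k → k < n → ∀ θ →
           coeff (P (suc k)) θ ≡ c (suc k) * mass (P k) * coeff (Λ (t (suc k))) θ - coeff (P k) θ
  P-step k k<n θ = begin
    coeff (P k *GR factor (suc k)) θ                      ≡⟨ coeff-*GR (P k) (factor (suc k)) θ ⟩
    conv (P k) (coeff (factor (suc k))) θ                 ≡⟨ conv-cong (P k) θ (coeff-factor (suc k)) ⟩
    conv (P k) (λ r → c′ * L r + (- 1ℚ) * coeff (Λ 1) r) θ ≡⟨ conv-linear (P k) L (coeff (Λ 1)) c′ (- 1ℚ) θ ⟩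
    c′ * conv (P k) L θ + (- 1ℚ) * conv (P k) (coeff (Λ 1)) θ ≡⟨ cong₂ (λ u v → c′ * u + (- 1ℚ) * v) absorb (conv-Λ1 (P k) θ) ⟩
    c′ * (mass (P k) * L θ) + (- 1ℚ) * coeff (P k) θ      ≡⟨ solve 4 (λ c M l p → c :* (M :* l) :+ (:- con 1ℚ) :* p := c :* M :* l :- p) refl c′ (mass (P k)) (L θ) (coeff (P k) θ) ⟩
    c′ * mass (P k) * L θ - coeff (P k) θ                 ∎
    where
    open ≡-Reasoning
    open ℚS.+-*-Solver
    c′ : ℚ
    c′ = c (suc k)
    L : ℚ → ℚ
    L = coeff (Λ (t (suc k)))
    absorb : conv (P k) L θ ≡ mass (P k) * L θ
    absorb = conv-invariant (P k) L θ (invariant (P-angles k (ℕP.<⇒≤ k<n) (t (suc k))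
               (λ j 1≤j j≤k → t-chain j (suc k) 1≤j (ℕP.m≤n⇒m≤1+n j≤k) k<n)))
      where
      invariant : ∀ {x} → AllAngles (Root (t (suc k))) x → AllAngles (λ φ → L (θ - φ) ≡ L θ) x
      invariant [] = []
      invariant (r ∷ rs) = Λ-periodic (t (suc k)) (t-pos (suc k) (s≤s z≤n) k<n) θ _ r ∷ invariant rs

  expansion : (d : ℕ → ℚ) → (∀ k → k < n → c (suc k) * mass (P k) ≡ d (suc k)) → ∀ θ →
              coeff (P n) θ ≡ sgnℚ n * coeff (Λ 1) θ + sum₁ n (λ j → sgnℚ (n ∸ j) * (d j * coeff (Λ (t j)) θ))
  expansion d d≡ θ = alternating-recurrence (λ k → coeff (P k) θ) (λ j → d j * coeff (Λ (t j)) θ) n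
    (λ k k<n → trans (P-step k k<n θ) (cong (λ u → u * coeff (Λ (t (suc k))) θ - coeff (P k) θ) (d≡ k k<n)))

sumℤ-neg : ∀ (f : ℕ → ℤ) xs → sumℤ (map (λ i → ℤ.- f i) xs) ≡ ℤ.- sumℤ (map f xs)
sumℤ-neg f [] = refl
sumℤ-neg f (x ∷ xs) = trans (cong (ℤ._+_ (ℤ.- f x)) (sumℤ-neg f xs)) (sym (ℤP.neg-distrib-+ (f x) (sumℤ (map f xs))))

ρ-∷ : ∀ x xs → ρ (x ∷ xs) ≡ productℤ (x ∷ xs) ℤ.- ρ xs
ρ-∷ x xs = begin
  h 0 ℤ.+ sumℤ (map h (applyUpTo suc L)) ℤ.+ sgn (suc L)   ≡⟨ cong (λ u → h 0 ℤ.+ sumℤ u ℤ.+ sgn (suc L)) tail-terms ⟩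
  h 0 ℤ.+ sumℤ (map (λ i → ℤ.- h′ i) (upTo L)) ℤ.+ ℤ.- sgn L ≡⟨ cong (λ u → h 0 ℤ.+ u ℤ.+ ℤ.- sgn L) (sumℤ-neg h′ (upTo L)) ⟩
  h 0 ℤ.+ ℤ.- Σ′ ℤ.+ ℤ.- sgn L                            ≡⟨ solve 3 (λ H S G → H :+ :- S :+ :- G := H :- (S :+ G)) refl (h 0) Σ′ (sgn L) ⟩
  h 0 ℤ.- ρ xs                                            ≡⟨ cong (ℤ._- ρ xs) (ℤP.*-identityˡ (productℤ (x ∷ xs))) ⟩
  productℤ (x ∷ xs) ℤ.- ρ xs                               ∎
  where
  open ≡-Reasoning
  open ℤS.+-*-Solver
  L : ℕ
  L = length xs
  h : ℕ → ℤ
  h i = sgn i ℤ.* productℤ (drop i (x ∷ xs))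
  h′ : ℕ → ℤ
  h′ i = sgn i ℤ.* productℤ (drop i xs)
  Σ′ : ℤ
  Σ′ = sumℤ (map h′ (upTo L))
  tail-terms : map h (applyUpTo suc L) ≡ map (λ i → ℤ.- h′ i) (upTo L)
  tail-terms = trans (ListP.map-applyUpTo suc h L)
    (trans (sym (ListP.map-upTo (h ∘ suc) L))
           (ListP.map-cong (λ i → sym (ℤP.neg-distribˡ-* (sgn i) (productℤ (drop i xs)))) (upTo L)))

productℤ-revA : ∀ a k → productℤ (revA a k) ≡ + prod1 a k
productℤ-revA a zero = refl
productℤ-revA a (suc k) = trans (cong (ℤ._*_ (+ a (suc k))) (productℤ-revA a k)) (sym (ℤP.pos-* (a (suc k)) (prod1 a k)))

ρ-revA : ∀ a k → ρ (revA a (suc k)) ≡ + prod1 a (suc k) ℤ.- ρ (revA a k)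
ρ-revA a k = trans (ρ-∷ (+ a (suc k)) (revA a k)) (cong (ℤ._- ρ (revA a k)) (productℤ-revA a (suc k)))

positive-fraction : ∀ w → 0ℚ ℚ.< w → w * ι (+ ↧ₙ w) ≡ ι (+ ℤ.∣ ↥ w ∣)
positive-fraction w@(mkℚ (+ p) d _) _ = trans (cong (_* ι (+ suc d)) (sym (ℚP.↥p/↧p≡p w))) (/-*-cancel (+ p) d)
positive-fraction (mkℚ ℤ.-[1+ p ] d _) (ℚ.*<* neg>0) = ⊥-elim (ℤP.<-asym neg>0 ℤ.-<+)

fraction-coprime : ∀ w → Coprime ℤ.∣ ↥ w ∣ (↧ₙ w)
fraction-coprime (mkℚ n d c) = Coprimality.recompute c

reduced-fraction : ∀ w X m → 1 ≤ m → w * ι (+ m) ≡ ι (+ X) →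
                   (ℤ.∣ ↥ w ∣ ℕ.* gcd X m ≡ X) × (↧ₙ w ℕ.* gcd X m ≡ m)
reduced-fraction w X (suc y) _ e = numerator , denominator
  where
  w≡ : w ≡ + X / suc y
  w≡ = *-cancelʳ-≢0 (ιℕ≢0 {suc y} (s≤s z≤n)) (trans e (sym (/-*-cancel (+ X) y)))
  numerator : ℤ.∣ ↥ w ∣ ℕ.* gcd X (suc y) ≡ X
  numerator = trans (sym (ℤP.abs-* (↥ w) (+ gcd X (suc y))))
                    (cong ℤ.∣_∣ (trans (cong (λ u → ↥ u ℤ.* + gcd X (suc y)) w≡) (ℚP.↥-/ (+ X) (suc y))))
  denominator : ↧ₙ w ℕ.* gcd X (suc y) ≡ suc y
  denominator = ℤP.+-injective (trans (ℤP.pos-* (↧ₙ w) (gcd X (suc y)))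
                    (trans (cong (λ u → ↧ u ℤ.* + gcd X (suc y)) w≡) (ℚP.↧-/ (+ X) (suc y))))

gcd-*-coprime : ∀ X a t → Coprime X t → gcd X (a ℕ.* t) ≡ gcd X a
gcd-*-coprime X a t X⊥t = ∣-antisym
  (gcd-greatest g∣X (coprime-divisor g⊥t (subst (g ∣_) (ℕP.*-comm a t) (gcd[m,n]∣n X (a ℕ.* t)))))
  (gcd-greatest (gcd[m,n]∣m X a) (∣-trans (gcd[m,n]∣n X a) (m∣m*n t)))
  where
  g = gcd X (a ℕ.* t)
  g∣X : g ∣ X
  g∣X = gcd[m,n]∣m X (a ℕ.* t)
  g⊥t : Coprime g t
  g⊥t (d∣g , d∣t) = X⊥t (∣-trans d∣g g∣X , d∣t)

coprime-∸ : ∀ s t → s ≤ t → Coprime s t → Coprime (t ∸ s) t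
coprime-∸ s t s≤t s⊥t {d} (d∣t-s , d∣t) = s⊥t (∣m+n∣m⇒∣n (subst (d ∣_) (sym (ℕP.m∸n+n≡m s≤t)) d∣t) d∣t-s , d∣t)

record StepFacts (a s′ t′ : ℕ) (w : ℚ) : Set where
  field
    num-β : ℤ.∣ ↥ w ∣ ℕ.* gcd (t′ ∸ s′) a ≡ t′ ∸ s′
    den-β : ↧ₙ w ℕ.* gcd (t′ ∸ s′) a ≡ a ℕ.* t′
    num-pos : 0 < ℤ.∣ ↥ w ∣
    num<den : ℤ.∣ ↥ w ∣ < ↧ₙ w
    β-pos : 1 ≤ gcd (t′ ∸ s′) a

step : ∀ (a s′ t′ : ℕ) (w′ w : ℚ) → 1 ≤ a → 0 < s′ → s′ < t′ → Coprime s′ t′ →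
       w′ * ι (+ t′) ≡ ι (+ s′) → 0ℚ ℚ.< w → ι (+ a) * w + w′ ≡ 1ℚ → StepFacts a s′ t′ w
step a s′ t′ w′ w 1≤a 0<s′ s′<t′ s′⊥t′ w′≡ 0<w aw+w′≡1 = record
  { num-β = num-β ; den-β = den-β ; num-pos = num-pos
  ; num<den = ℕP.*-cancelʳ-< β s t (subst₂ _<_ (sym num-β) (sym den-β) X<at′)
  ; β-pos = β-pos }
  where
  open ℚS.+-*-Solver
  X : ℕ
  X = t′ ∸ s′
  s : ℕ
  s = ℤ.∣ ↥ w ∣
  t : ℕ
  t = ↧ₙ w
  β : ℕ
  β = gcd X a
  1≤t′ : 1 ≤ t′
  1≤t′ = ℕP.≤-trans (s≤s z≤n) s′<t′
  -- w = (1 - w′)/a = (t′ - s′)/(a t′)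
  w-at′ : w * ι (+ (a ℕ.* t′)) ≡ ι (+ X)
  w-at′ = begin
    w * ι (+ (a ℕ.* t′))          ≡⟨ cong (w *_) (ιℕ-* a t′) ⟩
    w * (ι (+ a) * ι (+ t′))      ≡⟨ solve 3 (λ w A T → w :* (A :* T) := (A :* w) :* T) refl w (ι (+ a)) (ι (+ t′)) ⟩
    (ι (+ a) * w) * ι (+ t′)      ≡⟨ cong (_* ι (+ t′)) (trans (solve 2 (λ x y → x := (x :+ y) :- y) refl (ι (+ a) * w) w′) (cong (_- w′) aw+w′≡1)) ⟩
    (1ℚ - w′) * ι (+ t′)          ≡⟨ solve 2 (λ w′ T → (con 1ℚ :- w′) :* T := T :- w′ :* T) refl w′ (ι (+ t′)) ⟩
    ι (+ t′) - w′ * ι (+ t′)      ≡⟨ cong (λ u → ι (+ t′) - u) w′≡ ⟩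
    ι (+ t′) - ι (+ s′)           ≡⟨ sym (ιℕ-∸ t′ s′ (ℕP.<⇒≤ s′<t′)) ⟩
    ι (+ X)                       ∎
    where open ≡-Reasoning
  reduced : (s ℕ.* gcd X (a ℕ.* t′) ≡ X) × (t ℕ.* gcd X (a ℕ.* t′) ≡ a ℕ.* t′)
  reduced = reduced-fraction w X (a ℕ.* t′) (ℕP.*-mono-≤ 1≤a 1≤t′) w-at′
  β≡ : gcd X (a ℕ.* t′) ≡ β
  β≡ = gcd-*-coprime X a t′ (coprime-∸ s′ t′ (ℕP.<⇒≤ s′<t′) s′⊥t′)
  num-β : s ℕ.* β ≡ X
  num-β = trans (cong (s ℕ.*_) (sym β≡)) (proj₁ reduced)
  den-β : t ℕ.* β ≡ a ℕ.* t′
  den-β = trans (cong (t ℕ.*_) (sym β≡)) (proj₂ reduced)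
  β-pos : 1 ≤ β
  β-pos = ℕP.n≢0⇒n>0 λ β≡0 → ℕP.<⇒≢ (ℕP.*-mono-≤ 1≤a 1≤t′) (sym (trans (sym den-β) (trans (cong (t ℕ.*_) β≡0) (ℕP.*-zeroʳ t))))
  X<at′ : X < a ℕ.* t′
  X<at′ = ℕP.<-≤-trans (ℕP.∸-monoʳ-< {t′} {s′} {0} 0<s′ (ℕP.<⇒≤ s′<t′)) (ℕP.m≤n*m t′ a {{ℕ.>-nonZero 1≤a}})
  num-pos : 0 < s
  num-pos = ℕP.n≢0⇒n>0 λ s≡0 → ℕP.<⇒≢ (ℕP.m<n⇒0<n∸m s′<t′) (sym (trans (sym num-β) (cong (ℕ._* β) s≡0)))

divN-* : ∀ m d → 1 ≤ d → d ∣ m → divN m d ℕ.* d ≡ m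
divN-* m (suc d) _ d∣m = ℕDM.m/n*n≡m d∣m

module Sequence (n : ℕ) (a : ℕ → ℕ) (s0 t0 : ℕ) (1≤s0 : 1 ≤ s0) (s0<t0 : s0 < t0) (gcd≡1 : gcd s0 t0 ≡ 1)
  (a-pos : ∀ j → 1 ≤ j → j ≤ n → 1 ≤ a j) (w : ℕ → ℚ) (isSeq : IsSeq n a s0 t0 w) where

  s : ℕ → ℕ
  s = sOf s0 w
  t : ℕ → ℕ
  t = tOf t0 w
  β : ℕ → ℕ
  β = βOf a s0 t0 w
  α : ℕ → ℕ
  α = αOf a s0 t0 w
  A : ℕ → ℕ
  A = prod1 α
  B : ℕ → ℕ
  B = prod1 β

  t0≢0 : ι (+ t0) ≢ 0ℚ
  t0≢0 = ιℕ≢0 (ℕP.≤-trans (s≤s z≤n) s0<t0)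

  record Invariant (i : ℕ) : Set where
    field
      w-frac : w i * ι (+ t i) ≡ ι (+ s i)
      s-pos : 0 < s i
      s<t : s i < t i
      coprime : Coprime (s i) (t i)

  invariant : ∀ i → i ≤ n → Invariant i
  stepAt : ∀ i → suc i ≤ n → StepFacts (a (suc i)) (s i) (t i) (w (suc i))

  invariant zero _ = record
    { w-frac = trans (cong (_* ι (+ t0)) (proj₁ isSeq)) (qdiv-* (ι (+ s0)) (ι (+ t0)) t0≢0)
    ; s-pos = 1≤s0 ; s<t = s0<t0 ; coprime = gcd≡1⇒coprime gcd≡1 }
  invariant (suc i) i<n = record
    { w-frac = positive-fraction (w (suc i)) (proj₁ (proj₂ isSeq (suc i) (s≤s z≤n) i<n))
    ; s-pos = StepFacts.num-pos (stepAt i i<n)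
    ; s<t = StepFacts.num<den (stepAt i i<n)
    ; coprime = fraction-coprime (w (suc i)) }
  stepAt i i<n = step (a (suc i)) (s i) (t i) (w i) (w (suc i)) (a-pos (suc i) (s≤s z≤n) i<n)
      (Invariant.s-pos I) (Invariant.s<t I) (Invariant.coprime I) (Invariant.w-frac I) (proj₁ bounds) (proj₂ (proj₂ bounds))
    where
    I : Invariant i
    I = invariant i (ℕP.<⇒≤ i<n)
    bounds : (0ℚ ℚ.< w (suc i)) × (w (suc i) ℚ.< 1ℚ) × (ι (+ a (suc i)) * w (suc i) + w i ≡ 1ℚ)
    bounds = proj₂ isSeq (suc i) (s≤s z≤n) i<n

  s≤t : ∀ i → i ≤ n → s i ≤ t i
  s≤t i i≤n = ℕP.<⇒≤ (Invariant.s<t (invariant i i≤n))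

  s-pos : ∀ i → i ≤ n → 1 ≤ s i
  s-pos i i≤n = Invariant.s-pos (invariant i i≤n)

  t-pos : ∀ i → i ≤ n → 1 ≤ t i
  t-pos i i≤n = ℕP.<-≤-trans (Invariant.s-pos (invariant i i≤n)) (s≤t i i≤n)

  sβ : ∀ i → suc i ≤ n → s (suc i) ℕ.* β (suc i) ≡ t i ∸ s i
  sβ i i<n = StepFacts.num-β (stepAt i i<n)

  tβ : ∀ i → suc i ≤ n → t (suc i) ℕ.* β (suc i) ≡ a (suc i) ℕ.* t i
  tβ i i<n = StepFacts.den-β (stepAt i i<n)

  αβ : ∀ i → suc i ≤ n → α (suc i) ℕ.* β (suc i) ≡ a (suc i)
  αβ i i<n = divN-* (a (suc i)) (β (suc i)) (StepFacts.β-pos (stepAt i i<n)) (gcd[m,n]∣n (t i ∸ s i) (a (suc i)))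

  tα : ∀ i → suc i ≤ n → t (suc i) ≡ α (suc i) ℕ.* t i
  tα i i<n = ℕP.*-cancelʳ-≡ (t (suc i)) (α (suc i) ℕ.* t i) (β (suc i)) {{ℕ.>-nonZero (StepFacts.β-pos (stepAt i i<n))}} (begin
    t (suc i) ℕ.* β (suc i)              ≡⟨ tβ i i<n ⟩
    a (suc i) ℕ.* t i                    ≡⟨ cong (ℕ._* t i) (sym (αβ i i<n)) ⟩
    α (suc i) ℕ.* β (suc i) ℕ.* t i      ≡⟨ solve 3 (λ x y z → (x :* y) :* z := (x :* z) :* y) refl (α (suc i)) (β (suc i)) (t i) ⟩
    α (suc i) ℕ.* t i ℕ.* β (suc i)      ∎)
    where
    open ≡-Reasoning
    open ℕS.+-*-Solver

  tA : ∀ i → i ≤ n → t i ≡ A i ℕ.* t0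
  tA zero _ = sym (ℕP.*-identityˡ t0)
  tA (suc i) i<n = trans (tα i i<n) (trans (cong (α (suc i) ℕ.*_) (tA i (ℕP.<⇒≤ i<n))) (sym (ℕP.*-assoc (α (suc i)) (A i) t0)))

  AB : ∀ i → i ≤ n → A i ℕ.* B i ≡ prod1 a i
  AB zero _ = refl
  AB (suc i) i<n = trans (solve 4 (λ x y z u → (x :* y) :* (z :* u) := (x :* z) :* (y :* u)) refl (α (suc i)) (A i) (β (suc i)) (B i))
                         (cong₂ ℕ._*_ (αβ i i<n) (AB i (ℕP.<⇒≤ i<n)))
    where open ℕS.+-*-Solver

  t-chain : ∀ i j → i ≤ j → j ≤ n → t i ∣ t j
  t-chain i zero z≤n _ = ∣-refl
  t-chain i (suc j) i≤j+1 j<n with ℕP.m≤n⇒m<n∨m≡n i≤j+1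
  ... | inj₂ refl = ∣-refl
  ... | inj₁ (s≤s i≤j) = ∣-trans (t-chain i j i≤j (ℕP.<⇒≤ j<n)) (divides (α (suc j)) (tα j j<n))

  defect : ∀ k → k ≤ n → + B k ℤ.* (+ t k ℤ.- + s k) ≡ ρ (revA a k) ℤ.* + t0 ℤ.- sgn k ℤ.* + s0
  defect zero _ = solve 2 (λ x y → con (+ 1) :* (x :- y) := con (+ 1) :* x :- con (+ 1) :* y) refl (+ t0) (+ s0)
    where open ℤS.+-*-Solver
  defect (suc k) k<n = begin
    + (b′ ℕ.* B k) ℤ.* (+ t′ ℤ.- + s′)                 ≡⟨ cong (ℤ._* (+ t′ ℤ.- + s′)) (ℤP.pos-* b′ (B k)) ⟩
    + b′ ℤ.* + B k ℤ.* (+ t′ ℤ.- + s′)                  ≡⟨ solve 4 (λ b Bk T S → b :* Bk :* (T :- S) := Bk :* (T :* b) :- Bk :* (S :* b)) refl (+ b′) (+ B k) (+ t′) (+ s′) ⟩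
    + B k ℤ.* (+ t′ ℤ.* + b′) ℤ.- + B k ℤ.* (+ s′ ℤ.* + b′) ≡⟨ cong₂ (λ u v → + B k ℤ.* u ℤ.- + B k ℤ.* v) den num ⟩
    + B k ℤ.* (+ a′ ℤ.* + t k) ℤ.- + B k ℤ.* (+ t k ℤ.- + s k) ≡⟨ cong₂ (λ u v → + B k ℤ.* (+ a′ ℤ.* u) ℤ.- v) tk (defect k (ℕP.<⇒≤ k<n)) ⟩
    + B k ℤ.* (+ a′ ℤ.* (+ A k ℤ.* + t0)) ℤ.- (R ℤ.* + t0 ℤ.- sgn k ℤ.* + s0)
      ≡⟨ solve 7 (λ Bk a Ak T R g S → Bk :* (a :* (Ak :* T)) :- (R :* T :- g :* S) := (a :* (Ak :* Bk) :- R) :* T :- (:- g) :* S) refl (+ B k) (+ a′) (+ A k) (+ t0) R (sgn k) (+ s0) ⟩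
    (+ a′ ℤ.* (+ A k ℤ.* + B k) ℤ.- R) ℤ.* + t0 ℤ.- sgn (suc k) ℤ.* + s0 ≡⟨ cong (λ u → (+ a′ ℤ.* u ℤ.- R) ℤ.* + t0 ℤ.- sgn (suc k) ℤ.* + s0) AkBk ⟩
    (+ a′ ℤ.* + prod1 a k ℤ.- R) ℤ.* + t0 ℤ.- sgn (suc k) ℤ.* + s0 ≡⟨ cong (λ u → (u ℤ.- R) ℤ.* + t0 ℤ.- sgn (suc k) ℤ.* + s0) (sym (ℤP.pos-* a′ (prod1 a k))) ⟩
    (+ prod1 a (suc k) ℤ.- R) ℤ.* + t0 ℤ.- sgn (suc k) ℤ.* + s0 ≡⟨ cong (λ u → u ℤ.* + t0 ℤ.- sgn (suc k) ℤ.* + s0) (sym (ρ-revA a k)) ⟩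
    ρ (revA a (suc k)) ℤ.* + t0 ℤ.- sgn (suc k) ℤ.* + s0 ∎
    where
    open ≡-Reasoning
    open ℤS.+-*-Solver
    a′ : ℕ
    a′ = a (suc k)
    b′ : ℕ
    b′ = β (suc k)
    t′ : ℕ
    t′ = t (suc k)
    s′ : ℕ
    s′ = s (suc k)
    R : ℤ
    R = ρ (revA a k)
    den : + t′ ℤ.* + b′ ≡ + a′ ℤ.* + t k
    den = trans (sym (ℤP.pos-* t′ b′)) (trans (cong +_ (tβ k k<n)) (ℤP.pos-* a′ (t k)))
    num : + s′ ℤ.* + b′ ≡ + t k ℤ.- + s k
    num = trans (sym (ℤP.pos-* s′ b′)) (trans (cong +_ (sβ k k<n)) (+-∸ (t k) (s k) (s≤t k (ℕP.<⇒≤ k<n))))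
    tk : + t k ≡ + A k ℤ.* + t0
    tk = trans (cong +_ (tA k (ℕP.<⇒≤ k<n))) (ℤP.pos-* (A k) t0)
    AkBk : + A k ℤ.* + B k ≡ + prod1 a k
    AkBk = trans (sym (ℤP.pos-* (A k) (B k))) (cong +_ (AB k (ℕP.<⇒≤ k<n)))

  numerator-formula : ∀ i → suc i ≤ n → + s (suc i) ℤ.* + B (suc i) ≡ ρ (revA a i) ℤ.* + t0 ℤ.+ sgn (suc i) ℤ.* + s0
  numerator-formula i i<n = begin
    + s (suc i) ℤ.* + (β (suc i) ℕ.* B i)      ≡⟨ cong (ℤ._*_ (+ s (suc i))) (ℤP.pos-* (β (suc i)) (B i)) ⟩
    + s (suc i) ℤ.* (+ β (suc i) ℤ.* + B i)    ≡⟨ sym (ℤP.*-assoc (+ s (suc i)) (+ β (suc i)) (+ B i)) ⟩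
    + s (suc i) ℤ.* + β (suc i) ℤ.* + B i      ≡⟨ cong (ℤ._* + B i) (trans (sym (ℤP.pos-* (s (suc i)) (β (suc i)))) (trans (cong +_ (sβ i i<n)) (+-∸ (t i) (s i) (s≤t i (ℕP.<⇒≤ i<n))))) ⟩
    (+ t i ℤ.- + s i) ℤ.* + B i                ≡⟨ ℤP.*-comm (+ t i ℤ.- + s i) (+ B i) ⟩
    + B i ℤ.* (+ t i ℤ.- + s i)                ≡⟨ defect i (ℕP.<⇒≤ i<n) ⟩
    ρ (revA a i) ℤ.* + t0 ℤ.- sgn i ℤ.* + s0   ≡⟨ cong (ℤ._+_ (ρ (revA a i) ℤ.* + t0)) (ℤP.neg-distribˡ-* (sgn i) (+ s0)) ⟩
    ρ (revA a i) ℤ.* + t0 ℤ.+ sgn (suc i) ℤ.* + s0 ∎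
    where open ≡-Reasoning

  formulas : ∀ j → 1 ≤ j → j ≤ n →
             (+ s j ℤ.* + B j ≡ ρ (revA a (j ∸ 1)) ℤ.* + t0 ℤ.+ sgn j ℤ.* + s0)
             × (t j ≡ α j ℕ.* t (j ∸ 1)) × (t j ≡ A j ℕ.* t0)
  formulas (suc i) _ i<n = numerator-formula i i<n , tα i i<n , tA (suc i) i<n

  c : ℕ → ℚ
  c j = invN (s j)

  d : ℕ → ℚ
  d j = qdiv (ℕ→ℚ (B j)) (ℕ→ℚ (t0 ∸ s0))

  e : ℕ → ℚ
  e j = qdiv (ℕ→ℚ (prod1 a j)) (1ℚ - w 0)

  open Expansion n c t (λ j _ j≤n → t-pos j j≤n) (λ i j _ → t-chain i j)

  T0≢0 : ι (+ (t0 ∸ s0)) ≢ 0ℚ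
  T0≢0 = ιℕ≢0 (ℕP.m<n⇒0<n∸m s0<t0)

  one-minus-w0 : (1ℚ - w 0) * ι (+ t0) ≡ ι (+ (t0 ∸ s0))
  one-minus-w0 = begin
    (1ℚ - w 0) * ι (+ t0)          ≡⟨ solve 2 (λ w T → (con 1ℚ :- w) :* T := T :- w :* T) refl (w 0) (ι (+ t0)) ⟩
    ι (+ t0) - w 0 * ι (+ t0)      ≡⟨ cong (λ u → ι (+ t0) - u) (Invariant.w-frac (invariant 0 z≤n)) ⟩
    ι (+ t0) - ι (+ s0)            ≡⟨ sym (ιℕ-∸ t0 s0 (ℕP.<⇒≤ s0<t0)) ⟩
    ι (+ (t0 ∸ s0))                ∎
    where
    open ≡-Reasoning
    open ℚS.+-*-Solver

  1-w0≢0 : 1ℚ - w 0 ≢ 0ℚ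
  1-w0≢0 w0≡1 = T0≢0 (trans (sym one-minus-w0) (trans (cong (_* ι (+ t0)) w0≡1) (ℚP.*-zeroˡ (ι (+ t0)))))

  scaled-factor-mass : ∀ j → j ≤ n → ι (+ s j) * mass (factor j) ≡ ι (+ (t j ∸ s j))
  scaled-factor-mass j j≤n = begin
    ι (+ s j) * mass (factor j)                    ≡⟨ cong (ι (+ s j) *_) (mass-factor j) ⟩
    ι (+ s j) * (c j * ι (+ t j) - 1ℚ)             ≡⟨ solve 3 (λ S C T → S :* (C :* T :- con 1ℚ) := (C :* S) :* T :- S) refl (ι (+ s j)) (c j) (ι (+ t j)) ⟩
    (c j * ι (+ s j)) * ι (+ t j) - ι (+ s j)      ≡⟨ cong (λ u → u * ι (+ t j) - ι (+ s j)) (invN-* (s j) (s-pos j j≤n)) ⟩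
    1ℚ * ι (+ t j) - ι (+ s j)                     ≡⟨ cong (_- ι (+ s j)) (ℚP.*-identityˡ (ι (+ t j))) ⟩
    ι (+ t j) - ι (+ s j)                          ≡⟨ sym (ιℕ-∸ (t j) (s j) (s≤t j j≤n)) ⟩
    ι (+ (t j ∸ s j))                              ∎
    where
    open ≡-Reasoning
    open ℚS.+-*-Solver

  mass-P : ∀ k → k ≤ n → mass (P k) * ι (+ (t0 ∸ s0)) ≡ ι (+ B k) * ι (+ (t k ∸ s k))
  mass-P zero _ = solve 1 (λ x → (con 1ℚ :+ con 0ℚ) :* x := con 1ℚ :* x) refl (ι (+ (t0 ∸ s0)))
    where open ℚS.+-*-Solver
  mass-P (suc k) k<n = begin
    mass (P k *GR factor (suc k)) * T0             ≡⟨ cong (_* T0) (mass-*GR (P k) (factor (suc k))) ⟩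
    mass (P k) * F * T0                            ≡⟨ solve 3 (λ M F T → M :* F :* T := M :* T :* F) refl (mass (P k)) F T0 ⟩
    mass (P k) * T0 * F                            ≡⟨ cong (_* F) (mass-P k (ℕP.<⇒≤ k<n)) ⟩
    ι (+ B k) * ι (+ (t k ∸ s k)) * F              ≡⟨ cong (λ u → ι (+ B k) * u * F) (trans (cong (λ u → ι (+ u)) (sym (sβ k k<n))) (ιℕ-* s′ b′)) ⟩
    ι (+ B k) * (ι (+ s′) * ι (+ b′)) * F          ≡⟨ solve 4 (λ Bk S b F → Bk :* (S :* b) :* F := (b :* Bk) :* (S :* F)) refl (ι (+ B k)) (ι (+ s′)) (ι (+ b′)) F ⟩
    ι (+ b′) * ι (+ B k) * (ι (+ s′) * F)          ≡⟨ cong₂ _*_ (sym (ιℕ-* b′ (B k))) (scaled-factor-mass (suc k) k<n) ⟩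
    ι (+ B (suc k)) * ι (+ (t (suc k) ∸ s′))       ∎
    where
    open ≡-Reasoning
    open ℚS.+-*-Solver
    T0 : ℚ
    T0 = ι (+ (t0 ∸ s0))
    F : ℚ
    F = mass (factor (suc k))
    s′ : ℕ
    s′ = s (suc k)
    b′ : ℕ
    b′ = β (suc k)

  c-mass-P : ∀ k → k < n → c (suc k) * mass (P k) ≡ d (suc k)
  c-mass-P k k<n = sym (qdiv-unique T0≢0 (begin
    c′ * mass (P k) * T0                           ≡⟨ ℚP.*-assoc c′ (mass (P k)) T0 ⟩
    c′ * (mass (P k) * T0)                         ≡⟨ cong (c′ *_) (mass-P k (ℕP.<⇒≤ k<n)) ⟩
    c′ * (ι (+ B k) * ι (+ (t k ∸ s k)))           ≡⟨ cong (λ u → c′ * (ι (+ B k) * u)) (trans (cong (λ u → ι (+ u)) (sym (sβ k k<n))) (ιℕ-* s′ b′)) ⟩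
    c′ * (ι (+ B k) * (ι (+ s′) * ι (+ b′)))       ≡⟨ solve 4 (λ c Bk S b → c :* (Bk :* (S :* b)) := (c :* S) :* (b :* Bk)) refl c′ (ι (+ B k)) (ι (+ s′)) (ι (+ b′)) ⟩
    (c′ * ι (+ s′)) * (ι (+ b′) * ι (+ B k))       ≡⟨ cong₂ _*_ (invN-* s′ (s-pos (suc k) k<n)) (sym (ιℕ-* b′ (B k))) ⟩
    1ℚ * ι (+ B (suc k))                           ≡⟨ ℚP.*-identityˡ _ ⟩
    ι (+ B (suc k))                                ∎))
    where
    open ≡-Reasoning
    open ℚS.+-*-Solver
    T0 : ℚ
    T0 = ι (+ (t0 ∸ s0))
    c′ : ℚ
    c′ = c (suc k)
    s′ : ℕ
    s′ = s (suc k)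
    b′ : ℕ
    b′ = β (suc k)

  product-identity : prodGR factor n ≈GR sgnℚ n ·GR Λ 1 +GR sumGR (λ j → (sgnℚ (n ∸ j) * d j) ·GR Λ (t j)) n
  product-identity θ = begin
    coeff (P n) θ                                                              ≡⟨ expansion d c-mass-P θ ⟩
    sgnℚ n * coeff (Λ 1) θ + sum₁ n (λ j → sgnℚ (n ∸ j) * (d j * coeff (Λ (t j)) θ))
      ≡⟨ cong (λ u → sgnℚ n * coeff (Λ 1) θ + u) (sum₁-cong n λ j _ _ → sym (ℚP.*-assoc (sgnℚ (n ∸ j)) (d j) _)) ⟩
    sgnℚ n * coeff (Λ 1) θ + sum₁ n (λ j → sgnℚ (n ∸ j) * d j * coeff (Λ (t j)) θ)
      ≡⟨ sym (coeff-combination (sgnℚ n) (Λ 1) (λ j → sgnℚ (n ∸ j) * d j) (λ j → Λ (t j)) n θ) ⟩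
    coeff (sgnℚ n ·GR Λ 1 +GR sumGR (λ j → (sgnℚ (n ∸ j) * d j) ·GR Λ (t j)) n) θ ∎
    where open ≡-Reasoning

  -- d_j Λ_{t_j} = e_j E_{t_j}, since t_j = α_j...α_1 t_0 and α_j β_j = a_j.
  d≡e/t : ∀ j → j ≤ n → d j ≡ e j * invN (t j)
  d≡e/t j j≤n = qdiv-unique T0≢0 (begin
    e j * invN (t j) * ι (+ (t0 ∸ s0))                ≡⟨ cong (e j * invN (t j) *_) (sym one-minus-w0) ⟩
    e j * invN (t j) * ((1ℚ - w 0) * ι (+ t0))        ≡⟨ solve 4 (λ E I W T → E :* I :* (W :* T) := (E :* W) :* T :* I) refl (e j) (invN (t j)) (1ℚ - w 0) (ι (+ t0)) ⟩
    e j * (1ℚ - w 0) * ι (+ t0) * invN (t j)          ≡⟨ cong (λ u → u * ι (+ t0) * invN (t j)) e-1-w0 ⟩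
    ι (+ A j) * ι (+ B j) * ι (+ t0) * invN (t j)     ≡⟨ solve 4 (λ A B T I → A :* B :* T :* I := B :* (I :* (A :* T))) refl (ι (+ A j)) (ι (+ B j)) (ι (+ t0)) (invN (t j)) ⟩
    ι (+ B j) * (invN (t j) * (ι (+ A j) * ι (+ t0))) ≡⟨ cong (λ u → ι (+ B j) * (invN (t j) * u)) (trans (sym (ιℕ-* (A j) t0)) (cong (λ u → ι (+ u)) (sym (tA j j≤n)))) ⟩
    ι (+ B j) * (invN (t j) * ι (+ t j))              ≡⟨ cong (ι (+ B j) *_) (invN-* (t j) (t-pos j j≤n)) ⟩
    ι (+ B j) * 1ℚ                                    ≡⟨ ℚP.*-identityʳ _ ⟩
    ι (+ B j)                                         ∎)
    where
    open ≡-Reasoning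
    open ℚS.+-*-Solver
    e-1-w0 : e j * (1ℚ - w 0) ≡ ι (+ A j) * ι (+ B j)
    e-1-w0 = trans (qdiv-* (ℕ→ℚ (prod1 a j)) (1ℚ - w 0) 1-w0≢0) (trans (cong (λ u → ι (+ u)) (sym (AB j j≤n))) (ιℕ-* (A j) (B j)))

  idempotent-identity : sgnℚ n ·GR Λ 1 +GR sumGR (λ j → (sgnℚ (n ∸ j) * d j) ·GR Λ (t j)) n
                        ≈GR sgnℚ n ·GR E 1 +GR sumGR (λ j → (sgnℚ (n ∸ j) * e j) ·GR E (t j)) n
  idempotent-identity θ = begin
    coeff (sgnℚ n ·GR Λ 1 +GR sumGR (λ j → (sgnℚ (n ∸ j) * d j) ·GR Λ (t j)) n) θ
      ≡⟨ coeff-combination (sgnℚ n) (Λ 1) (λ j → sgnℚ (n ∸ j) * d j) (λ j → Λ (t j)) n θ ⟩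
    sgnℚ n * coeff (Λ 1) θ + sum₁ n (λ j → sgnℚ (n ∸ j) * d j * coeff (Λ (t j)) θ)
      ≡⟨ cong₂ (λ u v → sgnℚ n * u + v) (sym E1) (sum₁-cong n λ j _ j≤n → term j j≤n) ⟩
    sgnℚ n * coeff (E 1) θ + sum₁ n (λ j → sgnℚ (n ∸ j) * e j * coeff (E (t j)) θ)
      ≡⟨ sym (coeff-combination (sgnℚ n) (E 1) (λ j → sgnℚ (n ∸ j) * e j) (λ j → E (t j)) n θ) ⟩
    coeff (sgnℚ n ·GR E 1 +GR sumGR (λ j → (sgnℚ (n ∸ j) * e j) ·GR E (t j)) n) θ ∎
    where
    open ≡-Reasoning
    open ℚS.+-*-Solver
    E1 : coeff (E 1) θ ≡ coeff (Λ 1) θ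
    E1 = trans (coeff-E 1 (s≤s z≤n) θ)
           (trans (cong (_* coeff (Λ 1) θ) (trans (sym (ℚP.*-identityʳ (invN 1))) (invN-* 1 (s≤s z≤n)))) (ℚP.*-identityˡ _))
    term : ∀ j → j ≤ n → sgnℚ (n ∸ j) * d j * coeff (Λ (t j)) θ ≡ sgnℚ (n ∸ j) * e j * coeff (E (t j)) θ
    term j j≤n = begin
      sgnℚ (n ∸ j) * d j * coeff (Λ (t j)) θ                  ≡⟨ cong (λ u → sgnℚ (n ∸ j) * u * coeff (Λ (t j)) θ) (d≡e/t j j≤n) ⟩
      sgnℚ (n ∸ j) * (e j * invN (t j)) * coeff (Λ (t j)) θ   ≡⟨ solve 4 (λ g E I L → g :* (E :* I) :* L := g :* E :* (I :* L)) refl (sgnℚ (n ∸ j)) (e j) (invN (t j)) (coeff (Λ (t j)) θ) ⟩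
      sgnℚ (n ∸ j) * e j * (invN (t j) * coeff (Λ (t j)) θ)   ≡⟨ cong (sgnℚ (n ∸ j) * e j *_) (sym (coeff-E (t j) (t-pos j j≤n) θ)) ⟩
      sgnℚ (n ∸ j) * e j * coeff (E (t j)) θ                  ∎

  inverse-minus-one : ∀ j → j ≤ n → qdiv 1ℚ (w j) - 1ℚ ≡ mass (factor j)
  inverse-minus-one j j≤n = trans (cong (_- 1ℚ) (qdiv-unique {1ℚ} {w j} {c j * ι (+ t j)} w≢0 (begin
    c j * ι (+ t j) * w j        ≡⟨ ℚP.*-assoc (c j) (ι (+ t j)) (w j) ⟩
    c j * (ι (+ t j) * w j)      ≡⟨ cong (c j *_) (trans (ℚP.*-comm (ι (+ t j)) (w j)) (Invariant.w-frac (invariant j j≤n))) ⟩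
    c j * ι (+ s j)              ≡⟨ invN-* (s j) (s-pos j j≤n) ⟩
    1ℚ                           ∎))) (sym (mass-factor j))
    where
    open ≡-Reasoning
    w≢0 : w j ≢ 0ℚ
    w≢0 w≡0 = ιℕ≢0 {s j} (s-pos j j≤n) (trans (sym (Invariant.w-frac (invariant j j≤n))) (trans (cong (_* ι (+ t j)) w≡0) (ℚP.*-zeroˡ (ι (+ t j)))))

  product-mass : ∀ k → k ≤ n → prod1ℚ (λ j → qdiv 1ℚ (w j) - 1ℚ) k ≡ mass (P k)
  product-mass zero _ = sym (ℚP.+-identityʳ 1ℚ)
  product-mass (suc k) k<n = trans (cong₂ _*_ (inverse-minus-one (suc k) k<n) (product-mass k (ℕP.<⇒≤ k<n)))
    (trans (ℚP.*-comm (mass (factor (suc k))) (mass (P k))) (sym (mass-*GR (P k) (factor (suc k)))))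

  ratio-identity : prod1ℚ (λ j → qdiv 1ℚ (w j) - 1ℚ) n ≡ qdiv (ℤ→ℚ (ρ (revA a n)) - sgnℚ n * w 0) (1ℚ - w 0)
  ratio-identity = trans (product-mass n ℕP.≤-refl) (sym (qdiv-unique 1-w0≢0 (*-cancelʳ-≢0 t0≢0 (begin
    mass (P n) * (1ℚ - w 0) * ι (+ t0)                  ≡⟨ trans (ℚP.*-assoc (mass (P n)) (1ℚ - w 0) (ι (+ t0))) (cong (mass (P n) *_) one-minus-w0) ⟩
    mass (P n) * ι (+ (t0 ∸ s0))                        ≡⟨ mass-P n ℕP.≤-refl ⟩
    ι (+ B n) * ι (+ (t n ∸ s n))                       ≡⟨ trans (cong (λ u → ι (+ B n) * ι u) (+-∸ (t n) (s n) (s≤t n ℕP.≤-refl))) (sym (ι-* (+ B n) (+ t n ℤ.- + s n))) ⟩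
    ι (+ B n ℤ.* (+ t n ℤ.- + s n))                     ≡⟨ cong ι (defect n ℕP.≤-refl) ⟩
    ι (ρ (revA a n) ℤ.* + t0 ℤ.- sgn n ℤ.* + s0)        ≡⟨ trans (ι-- (ρ (revA a n) ℤ.* + t0) (sgn n ℤ.* + s0)) (cong₂ _-_ (ι-* (ρ (revA a n)) (+ t0)) (ι-* (sgn n) (+ s0))) ⟩
    ι (ρ (revA a n)) * ι (+ t0) - sgnℚ n * ι (+ s0)     ≡⟨ cong (λ u → ι (ρ (revA a n)) * ι (+ t0) - sgnℚ n * u) (sym (Invariant.w-frac (invariant 0 z≤n))) ⟩
    ι (ρ (revA a n)) * ι (+ t0) - sgnℚ n * (w 0 * ι (+ t0)) ≡⟨ solve 4 (λ r T g w → r :* T :- g :* (w :* T) := (r :- g :* w) :* T) refl (ι (ρ (revA a n))) (ι (+ t0)) (sgnℚ n) (w 0) ⟩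
    (ℤ→ℚ (ρ (revA a n)) - sgnℚ n * w 0) * ι (+ t0)      ∎))))
    where
    open ≡-Reasoning
    open ℚS.+-*-Solver

pos-from-* : ∀ x q p → x * ι (+ q) ≡ p → 0ℚ ℚ.< p → 0ℚ ℚ.< x
pos-from-* x q p e 0<p = ℚP.*-cancelʳ-<-nonNeg (ι (+ q)) {{ℚ.nonNegative (ι-mono-≤ {+ 0} {+ q} (ℤ.+≤+ z≤n))}}
  (subst₂ ℚ._<_ (sym (ℚP.*-zeroˡ (ι (+ q)))) (sym e) 0<p)

<1-from-* : ∀ x q p → x * ι (+ q) ≡ p → p ℚ.< ι (+ q) → x ℚ.< 1ℚ
<1-from-* x q p e p<q = ℚP.*-cancelʳ-<-nonNeg (ι (+ q)) {{ℚ.nonNegative (ι-mono-≤ {+ 0} {+ q} (ℤ.+≤+ z≤n))}}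
  (subst₂ ℚ._<_ (sym e) (sym (ℚP.*-identityˡ (ι (+ q)))) p<q)

0<q-p : ∀ {p q} → p ℚ.< q → 0ℚ ℚ.< q - p
0<q-p {p} {q} p<q = subst (ℚ._< q - p) (ℚP.+-inverseʳ p) (ℚP.+-monoˡ-< (- p) p<q)

module Existence (n : ℕ) (a : ℕ → ℕ) (s0 t0 : ℕ) (1≤s0 : 1 ≤ s0) (s0<t0 : s0 < t0)
  (a-pos : ∀ j → 1 ≤ j → j ≤ n → 1 ≤ a j) where

  a≢0 : ∀ j → 1 ≤ j → j ≤ n → ι (+ a j) ≢ 0ℚ
  a≢0 j 1≤j j≤n = ιℕ≢0 (a-pos j 1≤j j≤n)

  W : ℕ → ℚ
  W zero = qdiv (ℕ→ℚ s0) (ℕ→ℚ t0)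
  W (suc j) = qdiv (1ℚ - W j) (ℕ→ℚ (a (suc j)))

  -- 0 < W_i < 1, by induction: 0 < 1 - W_i < 1 ≤ a_{i+1}.
  bounds : ∀ i → i ≤ n → (0ℚ ℚ.< W i) × (W i ℚ.< 1ℚ)
  bounds zero _ = pos-from-* (W 0) t0 (ι (+ s0)) W0 (ι-mono-< (ℤ.+<+ 1≤s0)) , <1-from-* (W 0) t0 (ι (+ s0)) W0 (ι-mono-< (ℤ.+<+ s0<t0))
    where W0 = qdiv-* (ι (+ s0)) (ι (+ t0)) (ιℕ≢0 (ℕP.≤-trans (s≤s z≤n) s0<t0))
  bounds (suc i) i<n =
    pos-from-* (W (suc i)) (a (suc i)) (1ℚ - W i) Wi+1 (0<q-p (proj₂ IH)) ,
    <1-from-* (W (suc i)) (a (suc i)) (1ℚ - W i) Wi+1 (ℚP.<-≤-trans 1-Wi<1 (ι-mono-≤ (ℤ.+≤+ (a-pos (suc i) (s≤s z≤n) i<n))))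
    where
    IH : (0ℚ ℚ.< W i) × (W i ℚ.< 1ℚ)
    IH = bounds i (ℕP.<⇒≤ i<n)
    Wi+1 : W (suc i) * ι (+ a (suc i)) ≡ 1ℚ - W i
    Wi+1 = qdiv-* (1ℚ - W i) (ι (+ a (suc i))) (a≢0 (suc i) (s≤s z≤n) i<n)
    1-Wi<1 : 1ℚ - W i ℚ.< 1ℚ
    1-Wi<1 = subst (1ℚ - W i ℚ.<_) (ℚP.+-identityʳ 1ℚ) (ℚP.+-monoʳ-< 1ℚ (ℚP.neg-antimono-< (proj₁ IH)))

  exists : IsSeq n a s0 t0 W
  exists = refl , λ { (suc i) _ i<n → proj₁ (bounds (suc i) i<n) , proj₂ (bounds (suc i) i<n) , recursion i i<n }
    where
    open ℚS.+-*-Solver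
    recursion : ∀ i → suc i ≤ n → ι (+ a (suc i)) * W (suc i) + W i ≡ 1ℚ
    recursion i i<n = trans (cong (_+ W i) (trans (ℚP.*-comm (ι (+ a (suc i))) (W (suc i)))
                                                  (qdiv-* (1ℚ - W i) (ι (+ a (suc i))) (a≢0 (suc i) (s≤s z≤n) i<n))))
                            (solve 1 (λ x → con 1ℚ :- x :+ x := con 1ℚ) refl (W i))

  -- The recursion determines w_{i+1} from w_i, as a_{i+1} ≠ 0.
  unique : ∀ w w′ → IsSeq n a s0 t0 w → IsSeq n a s0 t0 w′ → ∀ i → i ≤ n → w i ≡ w′ i
  unique w w′ p p′ zero _ = trans (proj₁ p) (sym (proj₁ p′))
  unique w w′ p p′ (suc i) i<n = *-cancelʳ-≢0 (a≢0 (suc i) (s≤s z≤n) i<n)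
    (trans (ℚP.*-comm (w (suc i)) A) (trans (ℚ+Group.∙-cancelʳ (w i) (A * w (suc i)) (A * w′ (suc i)) same) (ℚP.*-comm A (w′ (suc i)))))
    where
    A : ℚ
    A = ι (+ a (suc i))
    same : A * w (suc i) + w i ≡ A * w′ (suc i) + w i
    same = trans (proj₂ (proj₂ (proj₂ p (suc i) (s≤s z≤n) i<n)))
                 (trans (sym (proj₂ (proj₂ (proj₂ p′ (suc i) (s≤s z≤n) i<n))))
                        (cong (λ u → A * w′ (suc i) + u) (sym (unique w w′ p p′ i (ℕP.<⇒≤ i<n)))))

lemma4p2 : (n : ℕ) (a : ℕ → ℕ) (s0 t0 : ℕ) →
  1 ≤ s0 → s0 < t0 → gcd s0 t0 ≡ 1 →
  (∀ j → 1 ≤ j → j ≤ n → 1 ≤ a j) →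
  (∃ λ w → IsSeq n a s0 t0 w) ×
  (∀ w w′ → IsSeq n a s0 t0 w → IsSeq n a s0 t0 w′ →
     ∀ j → 1 ≤ j → j ≤ n → w j ≡ w′ j) ×
  (∀ w → IsSeq n a s0 t0 w →
    let s = sOf s0 w
        t = tOf t0 w
        β = βOf a s0 t0 w
        α = αOf a s0 t0 w
    in (∀ j → 1 ≤ j → j ≤ n →
          ((+ s j) ℤ.* (+ prod1 β j)
             ≡ ρ (revA a (j ∸ 1)) ℤ.* (+ t0) ℤ.+ sgn j ℤ.* (+ s0))
          × (t j ≡ α j ℕ.* t (j ∸ 1))
          × (t j ≡ prod1 α j ℕ.* t0))
     × (prodGR (λ j → invN (s j) ·GR Λ (t j) -GR Λ 1) n
          ≈GR sgnℚ n ·GR Λ 1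
              +GR sumGR (λ j → (sgnℚ (n ∸ j) ℚ.* qdiv (ℕ→ℚ (prod1 β j)) (ℕ→ℚ (t0 ∸ s0)))
                                 ·GR Λ (t j)) n)
     × (sgnℚ n ·GR Λ 1
          +GR sumGR (λ j → (sgnℚ (n ∸ j) ℚ.* qdiv (ℕ→ℚ (prod1 β j)) (ℕ→ℚ (t0 ∸ s0)))
                             ·GR Λ (t j)) n
          ≈GR sgnℚ n ·GR E 1
              +GR sumGR (λ j → (sgnℚ (n ∸ j) ℚ.* qdiv (ℕ→ℚ (prod1 a j)) (1ℚ ℚ.- w 0))
                                 ·GR E (t j)) n)
     × (prod1ℚ (λ j → qdiv 1ℚ (w j) ℚ.- 1ℚ) n
          ≡ qdiv (ℤ→ℚ (ρ (revA a n)) ℚ.- sgnℚ n ℚ.* w 0) (1ℚ ℚ.- w 0)))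
lemma4p2 n a s0 t0 1≤s0 s0<t0 gcd≡1 a-pos =
  (W , exists) ,
  (λ w w′ p p′ j _ j≤n → unique w w′ p p′ j j≤n) ,
  λ w isSeq → let open Sequence n a s0 t0 1≤s0 s0<t0 gcd≡1 a-pos w isSeq in
    formulas , product-identity , idempotent-identity , ratio-identity
  where open Existence n a s0 t0 1≤s0 s0<t0 a-pos
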